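{- For all integers $n\geq 0$, $c_{8}(49n+r)\equiv 0 \pmod 2$ for each $r\in\{6,20,27,34,41,48\}$.
   Context: A partition of $n$ is a finite non-increasing sequence of positive integers (its parts) summing to $n$. Let $c_{8}(n)$ be the number of partitions of $n$ in which either (a) all parts are even and distinct, or (b) there is an integer $j\geq1$ such that the odd parts are exactly the odd integers $1,3,\ldots,2j-1$ (all of them appear, and no odd part exceeds $2j-1$), where the odd integers $\leq j$ appear once or twice and the odd integers $>j$ appear exactly once; the even parts $\leq j$ are distinct; and the even parts $>j$ are distinct and at least $2j+2$. Equivalently, $\sum_{n\ge0}c_8(n)q^n=\sum_{j\ge0}q^{j^2}\prod_{i=1}^{j}(1+q^i)\prod_{i\ge1}(1+q^{2j+2i})$. -}

module Defs where

open import Data.Nat using (ℕ; zero; suc; _+_; _*_; _∸_; _≤ᵇ_)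
open import Data.Bool using (if_then_else_)
open import Data.List using (List; []; _∷_; _++_; map; upTo)
open import Data.Nat.ListAction using (sum)

-- countDistinct xs m = coefficient of q^m in  ∏_{x ∈ xs} (1 + q^x)
-- (product over list positions).
countDistinct : List ℕ → ℕ → ℕ
countDistinct []       zero    = 1
countDistinct []       (suc _) = 0
countDistinct (x ∷ xs) m =
  countDistinct xs m + (if x ≤ᵇ m then countDistinct xs (m ∸ x) else 0)

-- The exponents of the factors of  ∏_{i=1}^{j} (1+q^i) · ∏_{i≥1} (1+q^{2j+2i}),
-- truncated to i ≤ n in the infinite product (factors with 2j+2i > n
-- cannot contribute to the coefficient of q^n for any exponent ≤ n).
factors : ℕ → ℕ → List ℕ
factors j n = map suc (upTo j) ++ map (λ i → 2 * j + 2 * suc i) (upTo n)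

-- Coefficient of q^n in  Σ_{j≥0} q^{j²} ∏_{i=1}^{j}(1+q^i) ∏_{i≥1}(1+q^{2j+2i}).
-- Only j with j² ≤ n (hence j ≤ n) contribute.
c8 : ℕ → ℕ
c8 n = sum (map term (upTo (suc n)))
  where
  term : ℕ → ℕ
  term j = if j * j ≤ᵇ n then countDistinct (factors j n) (n ∸ j * j) else 0

-- Modulo 2 the factors 1 + q^{2j+2i} are squares, so the generating function of c₈ is
-- congruent to (q;q)_∞ · Σ_j q^{j²} (q^{j+1};q)_∞. By Euler's pentagonal number theorem and
-- the first Rogers–Ramanujan identity this is Σ_k q^{k(3k−1)/2} · Σ_l q^{l(5l+1)/2}, so c₈(N)
-- is odd only if N = k(3k−1)/2 + l(5l+1)/2. As 6 · k(3k−1)/2 = s² − s for s = 3k or 1 − 3k, and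
-- 10 · l(5l+1)/2 = t² − t for t = −5l or 1 + 5l, multiplying by 30 turns this into
-- 30N + 5s + 3t = 5s² + 3t² with s, t ∈ ℕ, which has no solution even modulo 49 when
-- N ≡ 6, 20, 27, 34, 41, 48 (mod 49).
--
-- The two q-series identities are proved in finite form, with Gaussian binomials [n, c]_q
-- (Schur's polynomials for Rogers–Ramanujan), by telescoping in n; they pass to series by
-- comparing coefficients below degree N + 1, where (q;q)_N [n, c]_q ≡ 1 once c and n − c
-- are at least N.

module Submission where

open import Level using (0ℓ)
open import Algebra.Bundles using (CommutativeRing)
import Algebra.Solver.Ring
open import Algebra.Solver.Ring.AlmostCommutativeRing
  using (fromCommutativeRing; _-Raw-AlmostCommutative⟶_)
open import Data.Bool using (if_then_else_)
open import Data.Bool.Properties using (if-float)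
open import Data.Empty using (⊥-elim)
open import Data.List using (List; []; _∷_; _++_; map; applyUpTo)
open import Data.List.Membership.Propositional using (_∈_)
open import Data.List.Relation.Unary.Any using (here; there)
open import Data.Maybe using (Maybe; just; nothing)
open import Data.Nat using (ℕ; zero; suc; _+_; _*_; _∸_; _≤_; _<_; _≤ᵇ_; _%_; _/_; z≤n; s≤s; ⌊_/2⌋; parity)
import Data.Nat.Properties as ℕ
open import Data.Nat.DivMod using (m≡m%n+[m/n]*n; [m+kn]%n≡m%n; m%n<n)
open import Data.Nat.Divisibility using (_∣_; divides)
open import Data.Nat.ListAction using (sum)
open import Data.Nat.Tactic.RingSolver using (solve-∀)
open import Data.Parity.Base as ℙ using (Parity; 0ℙ; 1ℙ; _⁻¹)
import Data.Parity.Properties as ℙₚ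
open import Algebra.Properties.CommutativeSemigroup ℙₚ.+-commutativeSemigroup using (interchange)
open import Algebra.Properties.CommutativeSemigroup ℕ.+-commutativeSemigroup using (x∙yz≈y∙xz)
open import Data.Product using (_×_; _,_)
open import Data.Sum using (inj₁; inj₂)
open import Function using (id)
open import Relation.Binary.Bundles using (Setoid)
open import Relation.Binary.Structures using (IsEquivalence)
import Relation.Binary.Reasoning.Setoid
open import Relation.Binary.PropositionalEquality as ≡ using (_≡_; _≢_; refl)
open import Relation.Nullary.Decidable using (Dec; yes; no; True; toWitness; ¬?)
open import Defs

-- Formal power series over 𝔽₂

Series : Set
Series = ℕ → Parity

infix 4 _≈_
record _≈_ (f g : Series) : Set where
  constructor coeffwise
  field at : ∀ n → f n ≡ g n
open _≈_

0ₛ : Series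
0ₛ _ = 0ℙ

q^_ : ℕ → Series
(q^ zero) zero = 1ℙ
(q^ zero) (suc n) = 0ℙ
(q^ suc k) zero = 0ℙ
(q^ suc k) (suc n) = (q^ k) n

1ₛ : Series
1ₛ = q^ 0

tail : Series → Series
tail f n = f (suc n)

scale : Parity → Series → Series
scale c f n = c ℙ.* f n

infixl 6 _⊕_
infixl 7 _⊛_

-- Opaque, so that conversion checking never unfolds the convolution.
opaque
  _⊕_ : Series → Series → Series
  (f ⊕ g) n = f n ℙ.+ g n

  _⊛_ : Series → Series → Series
  (f ⊛ g) zero = f 0 ℙ.* g 0
  (f ⊛ g) (suc n) = (f 0 ℙ.* g (suc n)) ℙ.+ (tail f ⊛ g) n

opaque
  unfolding _⊕_ _⊛_

  ⊕-coeff : ∀ f g n → (f ⊕ g) n ≡ f n ℙ.+ g n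
  ⊕-coeff f g n = refl

  ⊛-cong-≤ : ∀ n {f f′ g g′} → (∀ i → i ≤ n → f i ≡ f′ i) → (∀ i → i ≤ n → g i ≡ g′ i) →
             (f ⊛ g) n ≡ (f′ ⊛ g′) n
  ⊛-cong-≤ zero ef eg = ≡.cong₂ ℙ._*_ (ef 0 z≤n) (eg 0 z≤n)
  ⊛-cong-≤ (suc n) ef eg =
    ≡.cong₂ ℙ._+_ (≡.cong₂ ℙ._*_ (ef 0 z≤n) (eg (suc n) ℕ.≤-refl))
                  (⊛-cong-≤ n (λ i i≤n → ef (suc i) (s≤s i≤n)) (λ i i≤n → eg i (ℕ.m≤n⇒m≤1+n i≤n)))

  ⊕-cong : ∀ {f f′ g g′} → f ≈ f′ → g ≈ g′ → f ⊕ g ≈ f′ ⊕ g′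
  ⊕-cong ef eg = coeffwise λ n → ≡.cong₂ ℙ._+_ (at ef n) (at eg n)

  ⊛-cong : ∀ {f f′ g g′} → f ≈ f′ → g ≈ g′ → f ⊛ g ≈ f′ ⊛ g′
  ⊛-cong ef eg = coeffwise λ n → ⊛-cong-≤ n (λ i _ → at ef i) (λ i _ → at eg i)

  ⊕-assoc : ∀ f g h → (f ⊕ g) ⊕ h ≈ f ⊕ (g ⊕ h)
  ⊕-assoc f g h = coeffwise λ n → ℙₚ.+-assoc (f n) (g n) (h n)

  ⊕-comm : ∀ f g → f ⊕ g ≈ g ⊕ f
  ⊕-comm f g = coeffwise λ n → ℙₚ.+-comm (f n) (g n)

  ⊕-identityˡ : ∀ f → 0ₛ ⊕ f ≈ f
  ⊕-identityˡ f = coeffwise λ n → refl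

  ⊕-identityʳ : ∀ f → f ⊕ 0ₛ ≈ f
  ⊕-identityʳ f = coeffwise λ n → ℙₚ.+-identityʳ (f n)

  ⊕-self : ∀ f → f ⊕ f ≈ 0ₛ
  ⊕-self f = coeffwise λ n → ℙₚ.p+p≡0ℙ (f n)

  ⊛-zeroˡ : ∀ g → 0ₛ ⊛ g ≈ 0ₛ
  ⊛-zeroˡ g = coeffwise go
    where
    go : ∀ n → (0ₛ ⊛ g) n ≡ 0ℙ
    go zero = refl
    go (suc n) = go n

  ⊛-identityˡ : ∀ g → 1ₛ ⊛ g ≈ g
  ⊛-identityˡ g = coeffwise go
    where
    go : ∀ n → (1ₛ ⊛ g) n ≡ g n
    go zero = refl
    go (suc n) = ≡.trans (≡.cong (g (suc n) ℙ.+_) (at (⊛-zeroˡ g) n)) (ℙₚ.+-identityʳ (g (suc n)))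

  ⊛-distribʳ : ∀ g f f′ → (f ⊕ f′) ⊛ g ≈ f ⊛ g ⊕ f′ ⊛ g
  ⊛-distribʳ g f f′ = coeffwise (go f f′)
    where
    go : ∀ f f′ n → ((f ⊕ f′) ⊛ g) n ≡ (f ⊛ g ⊕ f′ ⊛ g) n
    go f f′ zero = ℙₚ.*-distribʳ-+ (g 0) (f 0) (f′ 0)
    go f f′ (suc n) = ≡.trans
      (≡.cong₂ ℙ._+_ (ℙₚ.*-distribʳ-+ (g (suc n)) (f 0) (f′ 0)) (go (tail f) (tail f′) n))
      (interchange (f 0 ℙ.* g (suc n)) (f′ 0 ℙ.* g (suc n)) ((tail f ⊛ g) n) ((tail f′ ⊛ g) n))

  ⊛-distribˡ : ∀ f g g′ → f ⊛ (g ⊕ g′) ≈ f ⊛ g ⊕ f ⊛ g′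
  ⊛-distribˡ f g g′ = coeffwise (go f)
    where
    go : ∀ f n → (f ⊛ (g ⊕ g′)) n ≡ (f ⊛ g ⊕ f ⊛ g′) n
    go f zero = ℙₚ.*-distribˡ-+ (f 0) (g 0) (g′ 0)
    go f (suc n) = ≡.trans
      (≡.cong₂ ℙ._+_ (ℙₚ.*-distribˡ-+ (f 0) (g (suc n)) (g′ (suc n))) (go (tail f) n))
      (interchange (f 0 ℙ.* g (suc n)) (f 0 ℙ.* g′ (suc n)) ((tail f ⊛ g) n) ((tail f ⊛ g′) n))

  scale-⊛ : ∀ c f g n → (scale c f ⊛ g) n ≡ c ℙ.* (f ⊛ g) n
  scale-⊛ c f g zero = ℙₚ.*-assoc c (f 0) (g 0)
  scale-⊛ c f g (suc n) = ≡.trans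
    (≡.cong₂ ℙ._+_ (ℙₚ.*-assoc c (f 0) (g (suc n))) (scale-⊛ c (tail f) g n))
    (≡.sym (ℙₚ.*-distribˡ-+ c (f 0 ℙ.* g (suc n)) ((tail f ⊛ g) n)))

  ⊛-suc-tailʳ : ∀ f g n → (f ⊛ g) (suc n) ≡ (f (suc n) ℙ.* g 0) ℙ.+ (f ⊛ tail g) n
  ⊛-suc-tailʳ f g zero = ℙₚ.+-comm (f 0 ℙ.* g 1) (f 1 ℙ.* g 0)
  ⊛-suc-tailʳ f g (suc n) = begin
      a ℙ.+ (tail f ⊛ g) (suc n)                ≡⟨ ≡.cong (a ℙ.+_) (⊛-suc-tailʳ (tail f) g n) ⟩
      a ℙ.+ (b ℙ.+ (tail f ⊛ tail g) n)          ≡⟨ ≡.sym (ℙₚ.+-assoc a b _) ⟩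
      (a ℙ.+ b) ℙ.+ (tail f ⊛ tail g) n          ≡⟨ ≡.cong (ℙ._+ (tail f ⊛ tail g) n) (ℙₚ.+-comm a b) ⟩
      (b ℙ.+ a) ℙ.+ (tail f ⊛ tail g) n          ≡⟨ ℙₚ.+-assoc b a _ ⟩
      b ℙ.+ (f ⊛ tail g) (suc n)                ∎
    where
    open ≡.≡-Reasoning
    a b : Parity
    a = f 0 ℙ.* g (suc (suc n))
    b = f (suc (suc n)) ℙ.* g 0

  ⊛-comm : ∀ f g → f ⊛ g ≈ g ⊛ f
  ⊛-comm f g = coeffwise (go f g)
    where
    go : ∀ f g n → (f ⊛ g) n ≡ (g ⊛ f) n
    go f g zero = ℙₚ.*-comm (f 0) (g 0)
    go f g (suc n) = ≡.trans (≡.cong₂ ℙ._+_ (ℙₚ.*-comm (f 0) (g (suc n))) (go (tail f) g n))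
                             (≡.sym (⊛-suc-tailʳ g f n))

  ⊛-assoc : ∀ f g h → (f ⊛ g) ⊛ h ≈ f ⊛ (g ⊛ h)
  ⊛-assoc f g h = coeffwise (go f)
    where
    go : ∀ f n → ((f ⊛ g) ⊛ h) n ≡ (f ⊛ (g ⊛ h)) n
    go f zero = ℙₚ.*-assoc (f 0) (g 0) (h 0)
    go f (suc n) = begin
        ((f 0 ℙ.* g 0) ℙ.* h (suc n)) ℙ.+ (tail (f ⊛ g) ⊛ h) n
      ≡⟨ ≡.cong (a ℙ.+_) (at (⊛-distribʳ h (scale (f 0) (tail g)) (tail f ⊛ g)) n) ⟩
        ((f 0 ℙ.* g 0) ℙ.* h (suc n)) ℙ.+ ((scale (f 0) (tail g) ⊛ h) n ℙ.+ ((tail f ⊛ g) ⊛ h) n)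
      ≡⟨ ≡.cong (a ℙ.+_) (≡.cong₂ ℙ._+_ (scale-⊛ (f 0) (tail g) h n) (go (tail f) n)) ⟩
        ((f 0 ℙ.* g 0) ℙ.* h (suc n)) ℙ.+ ((f 0 ℙ.* (tail g ⊛ h) n) ℙ.+ (tail f ⊛ (g ⊛ h)) n)
      ≡⟨ ≡.sym (ℙₚ.+-assoc a _ _) ⟩
        (((f 0 ℙ.* g 0) ℙ.* h (suc n)) ℙ.+ (f 0 ℙ.* (tail g ⊛ h) n)) ℙ.+ (tail f ⊛ (g ⊛ h)) n
      ≡⟨ ≡.cong (ℙ._+ (tail f ⊛ (g ⊛ h)) n)
           (≡.trans (≡.cong (ℙ._+ (f 0 ℙ.* (tail g ⊛ h) n)) (ℙₚ.*-assoc (f 0) (g 0) (h (suc n))))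
                    (≡.sym (ℙₚ.*-distribˡ-+ (f 0) (g 0 ℙ.* h (suc n)) ((tail g ⊛ h) n)))) ⟩
        (f 0 ℙ.* (g ⊛ h) (suc n)) ℙ.+ (tail f ⊛ (g ⊛ h)) n
      ∎
      where
      open ≡.≡-Reasoning
      a : Parity
      a = (f 0 ℙ.* g 0) ℙ.* h (suc n)

≈-refl : ∀ {f} → f ≈ f
≈-refl = coeffwise λ n → refl

≈-sym : ∀ {f g} → f ≈ g → g ≈ f
≈-sym e = coeffwise λ n → ≡.sym (at e n)

≈-trans : ∀ {f g h} → f ≈ g → g ≈ h → f ≈ h
≈-trans e e′ = coeffwise λ n → ≡.trans (at e n) (at e′ n)

≈-reflexive : ∀ {f g} → f ≡ g → f ≈ g
≈-reflexive refl = ≈-refl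

≈-isEquivalence : IsEquivalence _≈_
≈-isEquivalence = record { refl = ≈-refl ; sym = ≈-sym ; trans = ≈-trans }

𝔽₂[[q]] : CommutativeRing 0ℓ 0ℓ
𝔽₂[[q]] = record
  { Carrier = Series ; _≈_ = _≈_ ; _+_ = _⊕_ ; _*_ = _⊛_ ; -_ = id ; 0# = 0ₛ ; 1# = 1ₛ
  ; isCommutativeRing = record
    { isRing = record
      { +-isAbelianGroup = record
        { isGroup = record
          { isMonoid = record
            { isSemigroup = record
              { isMagma = record { isEquivalence = ≈-isEquivalence ; ∙-cong = ⊕-cong }
              ; assoc = ⊕-assoc }
            ; identity = ⊕-identityˡ , ⊕-identityʳ }
          ; inverse = ⊕-self , ⊕-self
          ; ⁻¹-cong = id }
        ; comm = ⊕-comm }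
      ; *-cong = ⊛-cong
      ; *-assoc = ⊛-assoc
      ; *-identity = ⊛-identityˡ , λ g → ≈-trans (⊛-comm g 1ₛ) (⊛-identityˡ g)
      ; distrib = ⊛-distribˡ , ⊛-distribʳ }
    ; *-comm = ⊛-comm } }

open CommutativeRing 𝔽₂[[q]]
  using (setoid)
  renaming (zeroʳ to ⊛-zeroʳ; *-identityʳ to ⊛-identityʳ)

module ≈-Reasoning = Relation.Binary.Reasoning.Setoid setoid

constant : Parity → Series
constant 0ℙ = 0ₛ
constant 1ℙ = 1ₛ

constant-homomorphism : CommutativeRing.rawRing ℙₚ.+-*-commutativeRing
                       -Raw-AlmostCommutative⟶ fromCommutativeRing 𝔽₂[[q]]
constant-homomorphism = record
  { ⟦_⟧ = constant ; +-homo = +-homo ; *-homo = *-homo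
  ; -‿homo = λ _ → ≈-refl ; 0-homo = ≈-refl ; 1-homo = ≈-refl }
  where
  +-homo : ∀ a b → constant (a ℙ.+ b) ≈ constant a ⊕ constant b
  +-homo 0ℙ b = ≈-sym (⊕-identityˡ (constant b))
  +-homo 1ℙ 0ℙ = ≈-sym (⊕-identityʳ 1ₛ)
  +-homo 1ℙ 1ℙ = ≈-sym (⊕-self 1ₛ)
  *-homo : ∀ a b → constant (a ℙ.* b) ≈ constant a ⊛ constant b
  *-homo 0ℙ b = ≈-sym (⊛-zeroˡ (constant b))
  *-homo 1ℙ b = ≈-sym (⊛-identityˡ (constant b))

constant-≟ : ∀ a b → Maybe (constant a ≈ constant b)
constant-≟ a b with a ℙₚ.≟ b
... | yes refl = just ≈-refl
... | no _ = nothing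

-- Coefficients in 𝔽₂, so that the solver knows 1 + 1 = 0.
module Solver = Algebra.Solver.Ring _ (fromCommutativeRing 𝔽₂[[q]]) constant-homomorphism constant-≟
open Solver using (solve; _:=_; _:+_; _:*_)

𝟘 𝟙 : ∀ {n} → Solver.Polynomial n
𝟘 = Solver.con 0ℙ
𝟙 = Solver.con 1ℙ

⊛-left-comm : ∀ a x b → a ⊛ (x ⊛ b) ≈ x ⊛ (a ⊛ b)
⊛-left-comm = solve 3 (λ a x b → a :* (x :* b) := x :* (a :* b)) ≈-refl

opaque
  unfolding _⊛_

  q^-⊛-coeff-zero : ∀ k f → (q^ suc k ⊛ f) 0 ≡ 0ℙ
  q^-⊛-coeff-zero k f = refl

  q^-⊛-coeff-suc : ∀ k f n → (q^ suc k ⊛ f) (suc n) ≡ (q^ k ⊛ f) n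
  q^-⊛-coeff-suc k f n = refl

q^-⊛-coeff : ∀ k f n → (q^ k ⊛ f) n ≡ (if k ≤ᵇ n then f (n ∸ k) else 0ℙ)
q^-⊛-coeff zero f n = at (⊛-identityˡ f) n
q^-⊛-coeff (suc k) f zero = q^-⊛-coeff-zero k f
q^-⊛-coeff (suc k) f (suc n) = begin
  (q^ suc k ⊛ f) (suc n)                        ≡⟨ q^-⊛-coeff-suc k f n ⟩
  (q^ k ⊛ f) n                                  ≡⟨ q^-⊛-coeff k f n ⟩
  (if k ≤ᵇ n then f (n ∸ k) else 0ℙ)            ≡⟨ ≡.cong (λ b → if b then f (n ∸ k) else 0ℙ) (≤ᵇ-suc k n) ⟩
  (if suc k ≤ᵇ suc n then f (n ∸ k) else 0ℙ)    ∎
  where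
  open ≡.≡-Reasoning
  ≤ᵇ-suc : ∀ k n → (k ≤ᵇ n) ≡ (suc k ≤ᵇ suc n)
  ≤ᵇ-suc zero n = refl
  ≤ᵇ-suc (suc k) n = refl

q^-+ : ∀ a b → q^ a ⊛ q^ b ≈ q^ (a + b)
q^-+ zero b = ⊛-identityˡ (q^ b)
q^-+ (suc a) b = coeffwise λ where
  zero → q^-⊛-coeff-zero a (q^ b)
  (suc n) → ≡.trans (q^-⊛-coeff-suc a (q^ b) n) (at (q^-+ a b) n)

q^-⊛-q^-⊛ : ∀ a b f → q^ a ⊛ (q^ b ⊛ f) ≈ q^ (a + b) ⊛ f
q^-⊛-q^-⊛ a b f = ≈-trans (≈-sym (⊛-assoc (q^ a) (q^ b) f)) (⊛-cong (q^-+ a b) ≈-refl)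

q^-⊛-q^ : ∀ a b c d → a + b ≡ c + d → q^ a ⊛ q^ b ≈ q^ c ⊛ q^ d
q^-⊛-q^ a b c d e = ≈-trans (q^-+ a b) (≈-trans (≈-reflexive (≡.cong q^_ e)) (≈-sym (q^-+ c d)))

q^-coeff-≢ : ∀ {k n} → k ≢ n → (q^ k) n ≡ 0ℙ
q^-coeff-≢ {zero} {zero} 0≢0 = ⊥-elim (0≢0 refl)
q^-coeff-≢ {zero} {suc n} _ = refl
q^-coeff-≢ {suc k} {zero} _ = refl
q^-coeff-≢ {suc k} {suc n} 1+k≢1+n = q^-coeff-≢ (λ k≡n → 1+k≢1+n (≡.cong suc k≡n))

⊕-coeff-zero : ∀ f g n → f n ≡ 0ℙ → g n ≡ 0ℙ → (f ⊕ g) n ≡ 0ℙ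
⊕-coeff-zero f g n f≡0 g≡0 = ≡.trans (⊕-coeff f g n) (≡.cong₂ ℙ._+_ f≡0 g≡0)

-- Congruence modulo q^M, and finite sums

infix 4 _≈[_]_
record _≈[_]_ (f : Series) (M : ℕ) (g : Series) : Set where
  constructor below
  field at< : ∀ n → n < M → f n ≡ g n
open _≈[_]_

module _ {M : ℕ} where

  ≈⇒≈[] : ∀ {f g} → f ≈ g → f ≈[ M ] g
  ≈⇒≈[] e = below λ n _ → at e n

  ≈[]-refl : ∀ {f} → f ≈[ M ] f
  ≈[]-refl = below λ n _ → refl

  ≈[]-sym : ∀ {f g} → f ≈[ M ] g → g ≈[ M ] f
  ≈[]-sym e = below λ n n<M → ≡.sym (at< e n n<M)

  ≈[]-trans : ∀ {f g h} → f ≈[ M ] g → g ≈[ M ] h → f ≈[ M ] h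
  ≈[]-trans e e′ = below λ n n<M → ≡.trans (at< e n n<M) (at< e′ n n<M)

  ⊕-cong-≈[] : ∀ {f f′ g g′} → f ≈[ M ] f′ → g ≈[ M ] g′ → f ⊕ g ≈[ M ] f′ ⊕ g′
  ⊕-cong-≈[] {f} {f′} {g} {g′} e e′ = below λ n n<M → begin
    (f ⊕ g) n            ≡⟨ ⊕-coeff f g n ⟩
    f n ℙ.+ g n          ≡⟨ ≡.cong₂ ℙ._+_ (at< e n n<M) (at< e′ n n<M) ⟩
    f′ n ℙ.+ g′ n        ≡⟨ ⊕-coeff f′ g′ n ⟨
    (f′ ⊕ g′) n          ∎
    where open ≡.≡-Reasoning

  ⊛-cong-≈[] : ∀ {f f′ g g′} → f ≈[ M ] f′ → g ≈[ M ] g′ → f ⊛ g ≈[ M ] f′ ⊛ g′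
  ⊛-cong-≈[] e e′ = below λ n n<M →
    ⊛-cong-≤ n (λ i i≤n → at< e i (ℕ.≤-<-trans i≤n n<M)) (λ i i≤n → at< e′ i (ℕ.≤-<-trans i≤n n<M))

  q^-≈[]-0 : ∀ {k} → M ≤ k → q^ k ≈[ M ] 0ₛ
  q^-≈[]-0 M≤k = below λ n n<M → vanish (ℕ.<-≤-trans n<M M≤k)
    where
    vanish : ∀ {n k} → n < k → (q^ k) n ≡ 0ℙ
    vanish {zero} {suc k} _ = refl
    vanish {suc n} {suc k} (s≤s n<k) = vanish n<k

  q^-⊛-≈[]-0 : ∀ {k} f → M ≤ k → q^ k ⊛ f ≈[ M ] 0ₛ
  q^-⊛-≈[]-0 f M≤k = ≈[]-trans (⊛-cong-≈[] (q^-≈[]-0 M≤k) ≈[]-refl) (≈⇒≈[] (⊛-zeroˡ f))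

≈[]-setoid : ℕ → Setoid 0ℓ 0ℓ
≈[]-setoid M = record
  { Carrier = Series ; _≈_ = _≈[ M ]_
  ; isEquivalence = record { refl = ≈[]-refl ; sym = ≈[]-sym ; trans = ≈[]-trans } }

module ≈[]-Reasoning (M : ℕ) = Relation.Binary.Reasoning.Setoid (≈[]-setoid M)

∑ : ℕ → (ℕ → Series) → Series
∑ zero F = 0ₛ
∑ (suc L) F = F 0 ⊕ ∑ L (λ m → F (suc m))

syntax ∑ L (λ m → F) = ∑[ m < L ] F

∑-cong : ∀ L {F G} → (∀ m → m < L → F m ≈ G m) → ∑ L F ≈ ∑ L G
∑-cong zero F≈G = ≈-refl
∑-cong (suc L) F≈G = ⊕-cong (F≈G 0 (s≤s z≤n)) (∑-cong L (λ m m<L → F≈G (suc m) (s≤s m<L)))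

∑-cong-≈[] : ∀ L {M F G} → (∀ m → m < L → F m ≈[ M ] G m) → ∑ L F ≈[ M ] ∑ L G
∑-cong-≈[] zero F≈G = ≈[]-refl
∑-cong-≈[] (suc L) F≈G = ⊕-cong-≈[] (F≈G 0 (s≤s z≤n)) (∑-cong-≈[] L (λ m m<L → F≈G (suc m) (s≤s m<L)))

∑-zero : ∀ L {F} → (∀ m → m < L → F m ≈ 0ₛ) → ∑ L F ≈ 0ₛ
∑-zero L F≈0 = ≈-trans (∑-cong L F≈0) (zeros L)
  where
  zeros : ∀ L → ∑[ m < L ] 0ₛ ≈ 0ₛ
  zeros zero = ≈-refl
  zeros (suc L) = ≈-trans (⊕-identityˡ _) (zeros L)

∑-distrib-⊕ : ∀ L F G → ∑[ m < L ] (F m ⊕ G m) ≈ ∑ L F ⊕ ∑ L G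
∑-distrib-⊕ zero F G = ≈-sym (⊕-identityˡ 0ₛ)
∑-distrib-⊕ (suc L) F G = begin
  (F 0 ⊕ G 0) ⊕ ∑[ m < L ] (F (suc m) ⊕ G (suc m))      ≈⟨ ⊕-cong ≈-refl (∑-distrib-⊕ L _ _) ⟩
  (F 0 ⊕ G 0) ⊕ (∑[ m < L ] F (suc m) ⊕ ∑[ m < L ] G (suc m))
    ≈⟨ solve 4 (λ a b c d → (a :+ b) :+ (c :+ d) := (a :+ c) :+ (b :+ d)) ≈-refl (F 0) (G 0) _ _ ⟩
  (F 0 ⊕ ∑[ m < L ] F (suc m)) ⊕ (G 0 ⊕ ∑[ m < L ] G (suc m)) ∎
  where open ≈-Reasoning

⊛-distribˡ-∑ : ∀ L c F → c ⊛ ∑ L F ≈ ∑[ m < L ] (c ⊛ F m)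
⊛-distribˡ-∑ zero c F = ⊛-zeroʳ c
⊛-distribˡ-∑ (suc L) c F = ≈-trans (⊛-distribˡ c (F 0) _) (⊕-cong ≈-refl (⊛-distribˡ-∑ L c _))

∑-snoc : ∀ L F → ∑ (suc L) F ≈ ∑ L F ⊕ F L
∑-snoc zero F = ⊕-comm (F 0) 0ₛ
∑-snoc (suc L) F = ≈-trans (⊕-cong ≈-refl (∑-snoc L (λ m → F (suc m)))) (≈-sym (⊕-assoc (F 0) _ _))

∑-extend-≈[] : ∀ L k {M F} → (∀ m → L ≤ m → F m ≈[ M ] 0ₛ) → ∑ (k + L) F ≈[ M ] ∑ L F
∑-extend-≈[] L zero F≈0 = ≈[]-refl
∑-extend-≈[] L (suc k) {M} {F} F≈0 = begin
  ∑ (suc (k + L)) F      ≈⟨ ≈⇒≈[] (∑-snoc (k + L) F) ⟩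
  ∑ (k + L) F ⊕ F (k + L) ≈⟨ ⊕-cong-≈[] (∑-extend-≈[] L k F≈0) (F≈0 (k + L) (ℕ.m≤n+m L k)) ⟩
  ∑ L F ⊕ 0ₛ             ≈⟨ ≈⇒≈[] (⊕-identityʳ (∑ L F)) ⟩
  ∑ L F                  ∎
  where open ≈[]-Reasoning M

∑-telescope : ∀ L {Z u l : ℕ → Series} → (∀ m → Z m ≈ u m ⊕ l m) → (∀ m → l (suc m) ≈ u m) →
              ∑ (suc L) Z ≈ u L ⊕ l 0
∑-telescope zero Z≈u+l _ = ≈-trans (⊕-identityʳ _) (Z≈u+l 0)
∑-telescope (suc L) {Z} {u} {l} Z≈u+l l≈u = begin
  Z 0 ⊕ ∑[ m < suc L ] Z (suc m)
    ≈⟨ ⊕-cong (Z≈u+l 0) (∑-telescope L (λ m → Z≈u+l (suc m)) (λ m → l≈u (suc m))) ⟩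
  (u 0 ⊕ l 0) ⊕ (u (suc L) ⊕ l 1)
    ≈⟨ ⊕-cong ≈-refl (⊕-cong ≈-refl (l≈u 0)) ⟩
  (u 0 ⊕ l 0) ⊕ (u (suc L) ⊕ u 0)
    ≈⟨ solve 3 (λ a b c → (a :+ b) :+ (c :+ a) := c :+ b) ≈-refl (u 0) (l 0) (u (suc L)) ⟩
  u (suc L) ⊕ l 0                         ∎
  where open ≈-Reasoning

∑-coeff-zero : ∀ L F n → (∀ m → m < L → F m n ≡ 0ℙ) → ∑ L F n ≡ 0ℙ
∑-coeff-zero zero F n _ = refl
∑-coeff-zero (suc L) F n F≡0 = begin
  (F 0 ⊕ ∑[ m < L ] F (suc m)) n
    ≡⟨ ⊕-coeff (F 0) _ n ⟩
  F 0 n ℙ.+ (∑[ m < L ] F (suc m)) n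
    ≡⟨ ≡.cong₂ ℙ._+_ (F≡0 0 (s≤s z≤n)) (∑-coeff-zero L _ n (λ m m<L → F≡0 (suc m) (s≤s m<L))) ⟩
  0ℙ                                         ∎
  where open ≡.≡-Reasoning

∑-⊛-∑ : ∀ L L′ F G → ∑ L F ⊛ ∑ L′ G ≈ ∑[ u < L ] (∑[ v < L′ ] (F u ⊛ G v))
∑-⊛-∑ L L′ F G = begin
  ∑ L F ⊛ ∑ L′ G
    ≈⟨ ⊛-comm _ _ ⟩
  ∑ L′ G ⊛ ∑ L F
    ≈⟨ ⊛-distribˡ-∑ L (∑ L′ G) F ⟩
  ∑[ u < L ] (∑ L′ G ⊛ F u)
    ≈⟨ ∑-cong L (λ u _ → ≈-trans (⊛-comm _ _) (⊛-distribˡ-∑ L′ (F u) G)) ⟩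
  ∑[ u < L ] (∑[ v < L′ ] (F u ⊛ G v))    ∎
  where open ≈-Reasoning

∑q^-⊛-∑q^-coeff : ∀ L (f g : ℕ → ℕ) n → (∀ u v → f u + g v ≢ n) → (∑[ u < L ] q^ f u ⊛ ∑[ v < L ] q^ g v) n ≡ 0ℙ
∑q^-⊛-∑q^-coeff L f g n f+g≢n = ≡.trans (at (∑-⊛-∑ L L (λ u → q^ f u) (λ v → q^ g v)) n)
  (∑-coeff-zero L _ n λ u _ → ∑-coeff-zero L _ n λ v _ →
     ≡.trans (at (q^-+ (f u) (g v)) n) (q^-coeff-≢ (f+g≢n u v)))

-- Gaussian binomial coefficients and q-Pochhammer symbols

qbinom : ℕ → ℕ → Series
qbinom zero zero = 1ₛ
qbinom zero (suc c) = 0ₛ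
qbinom (suc n) zero = 1ₛ
qbinom (suc n) (suc c) = qbinom n c ⊕ q^ suc c ⊛ qbinom n (suc c)

qbinom-vanish : ∀ {n c} → n < c → qbinom n c ≈ 0ₛ
qbinom-vanish {zero} {suc c} _ = ≈-refl
qbinom-vanish {suc n} {suc c} (s≤s n<c) = begin
  qbinom n c ⊕ q^ suc c ⊛ qbinom n (suc c)
    ≈⟨ ⊕-cong (qbinom-vanish n<c) (⊛-cong ≈-refl (qbinom-vanish (ℕ.m<n⇒m<1+n n<c))) ⟩
  0ₛ ⊕ q^ suc c ⊛ 0ₛ
    ≈⟨ solve 1 (λ x → 𝟘 :+ x :* 𝟘 := 𝟘) ≈-refl (q^ suc c) ⟩
  0ₛ                                        ∎
  where open ≈-Reasoning

qbinom-0 : ∀ n → qbinom n 0 ≈ 1ₛ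
qbinom-0 zero = ≈-refl
qbinom-0 (suc n) = ≈-refl

qbinom-diag : ∀ n → qbinom n n ≈ 1ₛ
qbinom-diag zero = ≈-refl
qbinom-diag (suc n) = begin
  qbinom n n ⊕ q^ suc n ⊛ qbinom n (suc n)
    ≈⟨ ⊕-cong (qbinom-diag n) (⊛-cong ≈-refl (qbinom-vanish (ℕ.n<1+n n))) ⟩
  1ₛ ⊕ q^ suc n ⊛ 0ₛ
    ≈⟨ solve 1 (λ x → 𝟙 :+ x :* 𝟘 := 𝟙) ≈-refl (q^ suc n) ⟩
  1ₛ                                        ∎
  where open ≈-Reasoning

geometric-qbinom-1 : ∀ b → (1ₛ ⊕ q^ 1) ⊛ qbinom (suc b) 1 ≈ 1ₛ ⊕ q^ suc b
geometric-qbinom-1 zero = solve 1 (λ x → (𝟙 :+ x) :* (𝟙 :+ x :* 𝟘) := 𝟙 :+ x) ≈-refl (q^ 1)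
geometric-qbinom-1 (suc b) = begin
  (1ₛ ⊕ q^ 1) ⊛ (1ₛ ⊕ q^ 1 ⊛ qbinom (suc b) 1)
    ≈⟨ solve 2 (λ x β → (𝟙 :+ x) :* (𝟙 :+ x :* β) := (𝟙 :+ x) :+ x :* ((𝟙 :+ x) :* β)) ≈-refl (q^ 1) (qbinom (suc b) 1) ⟩
  (1ₛ ⊕ q^ 1) ⊕ q^ 1 ⊛ ((1ₛ ⊕ q^ 1) ⊛ qbinom (suc b) 1)
    ≈⟨ ⊕-cong ≈-refl (⊛-cong ≈-refl (geometric-qbinom-1 b)) ⟩
  (1ₛ ⊕ q^ 1) ⊕ q^ 1 ⊛ (1ₛ ⊕ q^ suc b)
    ≈⟨ solve 2 (λ x y → (𝟙 :+ x) :+ x :* (𝟙 :+ y) := 𝟙 :+ x :* y) ≈-refl (q^ 1) (q^ suc b) ⟩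
  1ₛ ⊕ q^ 1 ⊛ q^ suc b
    ≈⟨ ⊕-cong ≈-refl (q^-+ 1 (suc b)) ⟩
  1ₛ ⊕ q^ suc (suc b) ∎
  where open ≈-Reasoning

ratio-step : ∀ u v w z α β γ → (1ₛ ⊕ v) ⊛ α ≈ (1ₛ ⊕ u) ⊛ β → (1ₛ ⊕ z) ⊛ β ≈ (1ₛ ⊕ w) ⊛ γ → u ⊛ v ≈ w ⊛ z →
             (1ₛ ⊕ v) ⊛ (α ⊕ u ⊛ β) ≈ (1ₛ ⊕ w) ⊛ (β ⊕ w ⊛ γ)
ratio-step u v w z α β γ hα hβ uv≈wz = begin
  (1ₛ ⊕ v) ⊛ (α ⊕ u ⊛ β)
    ≈⟨ solve 4 (λ u v α β → (𝟙 :+ v) :* (α :+ u :* β) := (𝟙 :+ v) :* α :+ u :* ((𝟙 :+ v) :* β)) ≈-refl u v α β ⟩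
  (1ₛ ⊕ v) ⊛ α ⊕ u ⊛ ((1ₛ ⊕ v) ⊛ β)
    ≈⟨ ⊕-cong hα ≈-refl ⟩
  (1ₛ ⊕ u) ⊛ β ⊕ u ⊛ ((1ₛ ⊕ v) ⊛ β)
    ≈⟨ solve 3 (λ u v β → (𝟙 :+ u) :* β :+ u :* ((𝟙 :+ v) :* β) := (𝟙 :+ u :* v) :* β) ≈-refl u v β ⟩
  (1ₛ ⊕ u ⊛ v) ⊛ β
    ≈⟨ ⊛-cong (⊕-cong ≈-refl uv≈wz) ≈-refl ⟩
  (1ₛ ⊕ w ⊛ z) ⊛ β
    ≈⟨ solve 3 (λ w z β → (𝟙 :+ w :* z) :* β := (𝟙 :+ w) :* β :+ w :* ((𝟙 :+ z) :* β)) ≈-refl w z β ⟩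
  (1ₛ ⊕ w) ⊛ β ⊕ w ⊛ ((1ₛ ⊕ z) ⊛ β)
    ≈⟨ ⊕-cong ≈-refl (⊛-cong ≈-refl hβ) ⟩
  (1ₛ ⊕ w) ⊛ β ⊕ w ⊛ ((1ₛ ⊕ w) ⊛ γ)
    ≈⟨ solve 3 (λ w β γ → (𝟙 :+ w) :* β :+ w :* ((𝟙 :+ w) :* γ) := (𝟙 :+ w) :* (β :+ w :* γ)) ≈-refl w β γ ⟩
  (1ₛ ⊕ w) ⊛ (β ⊕ w ⊛ γ) ∎
  where open ≈-Reasoning

qbinom-ratio : ∀ c b → (1ₛ ⊕ q^ b) ⊛ qbinom (c + b) c ≈ (1ₛ ⊕ q^ suc c) ⊛ qbinom (c + b) (suc c)
qbinom-ratio c zero rewrite ℕ.+-identityʳ c = begin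
  (1ₛ ⊕ 1ₛ) ⊛ qbinom c c        ≈⟨ solve 1 (λ β → (𝟙 :+ 𝟙) :* β := 𝟘) ≈-refl (qbinom c c) ⟩
  0ₛ                            ≈⟨ ⊛-zeroʳ _ ⟨
  (1ₛ ⊕ q^ suc c) ⊛ 0ₛ          ≈⟨ ⊛-cong ≈-refl (qbinom-vanish (ℕ.n<1+n c)) ⟨
  (1ₛ ⊕ q^ suc c) ⊛ qbinom c (suc c) ∎
  where open ≈-Reasoning
qbinom-ratio zero (suc b) = begin
  (1ₛ ⊕ q^ suc b) ⊛ 1ₛ          ≈⟨ ⊛-identityʳ _ ⟩
  1ₛ ⊕ q^ suc b                 ≈⟨ geometric-qbinom-1 b ⟨
  (1ₛ ⊕ q^ 1) ⊛ qbinom (suc b) 1 ∎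
  where open ≈-Reasoning
qbinom-ratio (suc c) (suc b) rewrite ℕ.+-suc c b =
  ratio-step (q^ suc c) (q^ suc b) (q^ suc (suc c)) (q^ b)
             (qbinom n c) (qbinom n (suc c)) (qbinom n (suc (suc c)))
             (≡.subst (λ m → (1ₛ ⊕ q^ suc b) ⊛ qbinom m c ≈ (1ₛ ⊕ q^ suc c) ⊛ qbinom m (suc c))
                      (ℕ.+-suc c b) (qbinom-ratio c (suc b)))
             (qbinom-ratio (suc c) b)
             (q^-⊛-q^ (suc c) (suc b) (suc (suc c)) b (≡.cong suc (ℕ.+-suc c b)))
  where
  n : ℕ
  n = suc (c + b)

swap-pascal : ∀ α β u v → (1ₛ ⊕ v) ⊛ α ≈ (1ₛ ⊕ u) ⊛ β → α ⊕ u ⊛ β ≈ β ⊕ v ⊛ α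
swap-pascal α β u v h = begin
  α ⊕ u ⊛ β
    ≈⟨ solve 4 (λ α β u v → α :+ u :* β := (𝟙 :+ v) :* α :+ (β :+ u :* β) :+ (β :+ v :* α)) ≈-refl α β u v ⟩
  (1ₛ ⊕ v) ⊛ α ⊕ (β ⊕ u ⊛ β) ⊕ (β ⊕ v ⊛ α)
    ≈⟨ ⊕-cong (⊕-cong h ≈-refl) ≈-refl ⟩
  (1ₛ ⊕ u) ⊛ β ⊕ (β ⊕ u ⊛ β) ⊕ (β ⊕ v ⊛ α)
    ≈⟨ solve 4 (λ α β u v → (𝟙 :+ u) :* β :+ (β :+ u :* β) :+ (β :+ v :* α) := β :+ v :* α) ≈-refl α β u v ⟩
  β ⊕ v ⊛ α ∎
  where open ≈-Reasoning

qbinom-suc′ : ∀ n c → qbinom (suc n) (suc c) ≈ qbinom n (suc c) ⊕ q^ (n ∸ c) ⊛ qbinom n c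
qbinom-suc′ n c with ℕ.≤-<-connex c n
... | inj₁ c≤n = ≡.subst (λ m → qbinom (suc m) (suc c) ≈ qbinom m (suc c) ⊕ q^ (n ∸ c) ⊛ qbinom m c)
                         (ℕ.m+[n∸m]≡n c≤n)
                         (swap-pascal _ _ (q^ suc c) (q^ (n ∸ c)) (qbinom-ratio c (n ∸ c)))
... | inj₂ n<c = begin
  qbinom (suc n) (suc c)
    ≈⟨ qbinom-vanish (s≤s n<c) ⟩
  0ₛ
    ≈⟨ solve 1 (λ x → 𝟘 := 𝟘 :+ x :* 𝟘) ≈-refl (q^ (n ∸ c)) ⟩
  0ₛ ⊕ q^ (n ∸ c) ⊛ 0ₛ
    ≈⟨ ⊕-cong (qbinom-vanish (ℕ.m<n⇒m<1+n n<c)) (⊛-cong ≈-refl (qbinom-vanish n<c)) ⟨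
  qbinom n (suc c) ⊕ q^ (n ∸ c) ⊛ qbinom n c   ∎
  where open ≈-Reasoning

qbinom-sym : ∀ a b → qbinom (a + b) a ≈ qbinom (a + b) b
qbinom-sym zero b = ≈-trans (qbinom-0 b) (≈-sym (qbinom-diag b))
qbinom-sym (suc a) zero rewrite ℕ.+-identityʳ a = qbinom-diag (suc a)
qbinom-sym (suc a) (suc b) = begin
  qbinom (a + suc b) a ⊕ q^ suc a ⊛ qbinom (a + suc b) (suc a)
    ≈⟨ ⊕-cong (qbinom-sym a (suc b))
              (⊛-cong ≈-refl (≡.subst (λ n → qbinom n (suc a) ≈ qbinom n b) (≡.sym (ℕ.+-suc a b)) (qbinom-sym (suc a) b))) ⟩
  qbinom (a + suc b) (suc b) ⊕ q^ suc a ⊛ qbinom (a + suc b) b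
    ≈⟨ ⊕-cong ≈-refl (⊛-cong (≈-reflexive (≡.cong q^_ (≡.sym a+1+b∸b≡1+a))) ≈-refl) ⟩
  qbinom (a + suc b) (suc b) ⊕ q^ (a + suc b ∸ b) ⊛ qbinom (a + suc b) b
    ≈⟨ qbinom-suc′ (a + suc b) b ⟨
  qbinom (suc (a + suc b)) (suc b) ∎
  where
  open ≈-Reasoning
  a+1+b∸b≡1+a : a + suc b ∸ b ≡ suc a
  a+1+b∸b≡1+a = ≡.trans (≡.cong (_∸ b) (ℕ.+-suc a b)) (ℕ.m+n∸n≡m (suc a) b)

-- (1 + q^{a+1}) ⋯ (1 + q^{a+m}), the q-Pochhammer symbol (q^{a+1}; q)_m mod 2.
poch : ℕ → ℕ → Series
poch a zero = 1ₛ
poch a (suc m) = (1ₛ ⊕ q^ suc a) ⊛ poch (suc a) m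

poch-+ : ∀ a k l → poch a (k + l) ≈ poch a k ⊛ poch (a + k) l
poch-+ a zero l rewrite ℕ.+-identityʳ a = ≈-sym (⊛-identityˡ (poch a l))
poch-+ a (suc k) l = begin
  (1ₛ ⊕ q^ suc a) ⊛ poch (suc a) (k + l)
    ≈⟨ ⊛-cong ≈-refl (poch-+ (suc a) k l) ⟩
  (1ₛ ⊕ q^ suc a) ⊛ (poch (suc a) k ⊛ poch (suc a + k) l)
    ≈⟨ ⊛-assoc _ _ _ ⟨
  ((1ₛ ⊕ q^ suc a) ⊛ poch (suc a) k) ⊛ poch (suc a + k) l
    ≡⟨ ≡.cong (λ m → (1ₛ ⊕ q^ suc a) ⊛ poch (suc a) k ⊛ poch m l) (≡.sym (ℕ.+-suc a k)) ⟩
  ((1ₛ ⊕ q^ suc a) ⊛ poch (suc a) k) ⊛ poch (a + suc k) l    ∎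
  where open ≈-Reasoning

poch-suc : ∀ a k → poch a (suc k) ≈ poch a k ⊛ (1ₛ ⊕ q^ suc (a + k))
poch-suc a k = begin
  poch a (suc k)                            ≡⟨ ≡.cong (poch a) (ℕ.+-comm 1 k) ⟩
  poch a (k + 1)                            ≈⟨ poch-+ a k 1 ⟩
  poch a k ⊛ ((1ₛ ⊕ q^ suc (a + k)) ⊛ 1ₛ)   ≈⟨ ⊛-cong ≈-refl (⊛-identityʳ _) ⟩
  poch a k ⊛ (1ₛ ⊕ q^ suc (a + k))          ∎
  where open ≈-Reasoning

qbinom-⊛-poch : ∀ a b → qbinom (a + b) a ⊛ poch 0 a ≈ poch b a
qbinom-⊛-poch zero b = ≈-trans (⊛-cong (qbinom-0 b) ≈-refl) (⊛-identityˡ 1ₛ)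
qbinom-⊛-poch (suc a) b = begin
  qbinom (suc (a + b)) (suc a) ⊛ poch 0 (suc a)
    ≈⟨ ⊛-cong ≈-refl (poch-suc 0 a) ⟩
  qbinom (suc (a + b)) (suc a) ⊛ (poch 0 a ⊛ (1ₛ ⊕ u))
    ≈⟨ solve 3 (λ x y z → x :* (y :* z) := (z :* x) :* y) ≈-refl (qbinom (suc (a + b)) (suc a)) (poch 0 a) (1ₛ ⊕ u) ⟩
  ((1ₛ ⊕ u) ⊛ (α ⊕ u ⊛ β)) ⊛ poch 0 a
    ≈⟨ ⊛-cong shift-ratio ≈-refl ⟩
  ((1ₛ ⊕ q^ suc (a + b)) ⊛ α) ⊛ poch 0 a
    ≈⟨ ⊛-assoc _ _ _ ⟩
  (1ₛ ⊕ q^ suc (a + b)) ⊛ (α ⊛ poch 0 a)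
    ≈⟨ ⊛-cong ≈-refl (qbinom-⊛-poch a b) ⟩
  (1ₛ ⊕ q^ suc (a + b)) ⊛ poch b a
    ≈⟨ ⊛-comm _ _ ⟩
  poch b a ⊛ (1ₛ ⊕ q^ suc (a + b))
    ≡⟨ ≡.cong (λ m → poch b a ⊛ (1ₛ ⊕ q^ suc m)) (ℕ.+-comm a b) ⟩
  poch b a ⊛ (1ₛ ⊕ q^ suc (b + a))
    ≈⟨ poch-suc b a ⟨
  poch b (suc a) ∎
  where
  open ≈-Reasoning
  u v α β : Series
  u = q^ suc a
  v = q^ b
  α = qbinom (a + b) a
  β = qbinom (a + b) (suc a)
  shift-ratio : (1ₛ ⊕ u) ⊛ (α ⊕ u ⊛ β) ≈ (1ₛ ⊕ q^ suc (a + b)) ⊛ α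
  shift-ratio = begin
    (1ₛ ⊕ u) ⊛ (α ⊕ u ⊛ β)
      ≈⟨ solve 3 (λ u α β → (𝟙 :+ u) :* (α :+ u :* β) := (𝟙 :+ u) :* α :+ u :* ((𝟙 :+ u) :* β)) ≈-refl u α β ⟩
    (1ₛ ⊕ u) ⊛ α ⊕ u ⊛ ((1ₛ ⊕ u) ⊛ β)
      ≈⟨ ⊕-cong ≈-refl (⊛-cong ≈-refl (qbinom-ratio a b)) ⟨
    (1ₛ ⊕ u) ⊛ α ⊕ u ⊛ ((1ₛ ⊕ v) ⊛ α)
      ≈⟨ solve 3 (λ u v α → (𝟙 :+ u) :* α :+ u :* ((𝟙 :+ v) :* α) := (𝟙 :+ u :* v) :* α) ≈-refl u v α ⟩
    (1ₛ ⊕ u ⊛ v) ⊛ α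
      ≈⟨ ⊛-cong (⊕-cong ≈-refl (q^-+ (suc a) b)) ≈-refl ⟩
    (1ₛ ⊕ q^ suc (a + b)) ⊛ α ∎

poch-≈[]-1 : ∀ {M} a k → M ≤ suc a → poch a k ≈[ M ] 1ₛ
poch-≈[]-1 a zero _ = ≈[]-refl
poch-≈[]-1 {M} a (suc k) M≤1+a = begin
  (1ₛ ⊕ q^ suc a) ⊛ poch (suc a) k  ≈⟨ ⊛-cong-≈[] ≈[]-refl (poch-≈[]-1 (suc a) k (ℕ.m≤n⇒m≤1+n M≤1+a)) ⟩
  (1ₛ ⊕ q^ suc a) ⊛ 1ₛ              ≈⟨ ≈⇒≈[] (⊛-identityʳ _) ⟩
  1ₛ ⊕ q^ suc a                     ≈⟨ ⊕-cong-≈[] ≈[]-refl (q^-≈[]-0 M≤1+a) ⟩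
  1ₛ ⊕ 0ₛ                           ≈⟨ ≈⇒≈[] (⊕-identityʳ 1ₛ) ⟩
  1ₛ                                ∎
  where open ≈[]-Reasoning M

poch-+-≈[] : ∀ {M} a k l → M ≤ suc (a + k) → poch a (k + l) ≈[ M ] poch a k
poch-+-≈[] {M} a k l M≤1+a+k = begin
  poch a (k + l)                ≈⟨ ≈⇒≈[] (poch-+ a k l) ⟩
  poch a k ⊛ poch (a + k) l     ≈⟨ ⊛-cong-≈[] ≈[]-refl (poch-≈[]-1 (a + k) l M≤1+a+k) ⟩
  poch a k ⊛ 1ₛ                 ≈⟨ ≈⇒≈[] (⊛-identityʳ (poch a k)) ⟩
  poch a k                      ∎
  where open ≈[]-Reasoning M

-- Sums of q^e [n, ⌊x/2⌋]

parity-suc : ∀ x → parity (suc x) ≡ parity x ⁻¹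
parity-suc zero = refl
parity-suc (suc zero) = refl
parity-suc (suc (suc x)) = parity-suc x

⌊suc/2⌋-even : ∀ x → parity x ≡ 0ℙ → ⌊ suc x /2⌋ ≡ ⌊ x /2⌋
⌊suc/2⌋-even zero _ = refl
⌊suc/2⌋-even (suc (suc x)) e = ≡.cong suc (⌊suc/2⌋-even x e)

⌊suc/2⌋-odd : ∀ x → parity x ≡ 1ℙ → ⌊ suc x /2⌋ ≡ suc ⌊ x /2⌋
⌊suc/2⌋-odd (suc zero) _ = refl
⌊suc/2⌋-odd (suc (suc x)) e = ≡.cong suc (⌊suc/2⌋-odd x e)

even⇒≡⌊/2⌋+⌊/2⌋ : ∀ x → parity x ≡ 0ℙ → x ≡ ⌊ x /2⌋ + ⌊ x /2⌋
even⇒≡⌊/2⌋+⌊/2⌋ zero _ = refl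
even⇒≡⌊/2⌋+⌊/2⌋ (suc (suc x)) e =
  ≡.cong suc (≡.trans (≡.cong suc (even⇒≡⌊/2⌋+⌊/2⌋ x e)) (≡.sym (ℕ.+-suc ⌊ x /2⌋ ⌊ x /2⌋)))

odd⇒≡1+⌊/2⌋+⌊/2⌋ : ∀ x → parity x ≡ 1ℙ → x ≡ suc (⌊ x /2⌋ + ⌊ x /2⌋)
odd⇒≡1+⌊/2⌋+⌊/2⌋ (suc zero) _ = refl
odd⇒≡1+⌊/2⌋+⌊/2⌋ (suc (suc x)) e =
  ≡.cong suc (≡.trans (≡.cong suc (odd⇒≡1+⌊/2⌋+⌊/2⌋ x e)) (≡.cong suc (≡.sym (ℕ.+-suc ⌊ x /2⌋ ⌊ x /2⌋))))

n≤⌊x/2⌋ : ∀ {n x} → n + n ≤ x → n ≤ ⌊ x /2⌋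
n≤⌊x/2⌋ {n} n+n≤x = ℕ.≤-trans (ℕ.≤-reflexive (ℕ.n≡⌊n+n/2⌋ n)) (ℕ.⌊n/2⌋-mono n+n≤x)

q^-⊛-qbinom-cong : ∀ n c {a b} → (c ≤ n → a ≡ b) → q^ a ⊛ qbinom n c ≈ q^ b ⊛ qbinom n c
q^-⊛-qbinom-cong n c {a} {b} a≡b with ℕ.≤-<-connex c n
... | inj₁ c≤n = ⊛-cong (≈-reflexive (≡.cong q^_ (a≡b c≤n))) ≈-refl
... | inj₂ n<c = begin
  q^ a ⊛ qbinom n c   ≈⟨ ⊛-cong ≈-refl (qbinom-vanish n<c) ⟩
  q^ a ⊛ 0ₛ           ≈⟨ ⊛-zeroʳ (q^ a) ⟩
  0ₛ                  ≈⟨ ⊛-zeroʳ (q^ b) ⟨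
  q^ b ⊛ 0ₛ           ≈⟨ ⊛-cong ≈-refl (qbinom-vanish n<c) ⟨
  q^ b ⊛ qbinom n c   ∎
  where open ≈-Reasoning

q^-⊛-qbinom-⌊/2⌋-vanish : ∀ e n s → suc (suc n) ≤ s → q^ e ⊛ qbinom n ⌊ n + s /2⌋ ≈ 0ₛ
q^-⊛-qbinom-⌊/2⌋-vanish e n s 2+n≤s =
  ≈-trans (⊛-cong ≈-refl (qbinom-vanish (n≤⌊x/2⌋ (ℕ.≤-trans (ℕ.≤-reflexive (≡.sym (ℕ.+-suc n (suc n))))
                                                             (ℕ.+-monoʳ-≤ n 2+n≤s)))))
          (⊛-zeroʳ (q^ e))

shift-exponent : ∀ e s k {n c} → k + (n + s) ≡ suc (c + c) → suc c ≤ n → e + s + suc k + (n ∸ suc c) ≡ e + suc c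
shift-exponent e s k {n} {c} k+n+s≡1+2c c<n = begin
  e + s + suc k + r      ≡⟨ regroup e s k r ⟩
  e + suc (k + (r + s))  ≡⟨ ≡.cong (λ z → e + suc z) k+r+s≡c ⟩
  e + suc c              ∎
  where
  open ≡.≡-Reasoning
  r : ℕ
  r = n ∸ suc c
  regroup : ∀ e s k r → e + s + suc k + r ≡ e + suc (k + (r + s))
  regroup = solve-∀
  k+r+s≡c : k + (r + s) ≡ c
  k+r+s≡c = ℕ.+-cancelˡ-≡ c _ _ (ℕ.suc-injective (begin
    suc (c + (k + (r + s)))  ≡⟨ regroup′ c k r s ⟩
    k + (suc c + r + s)      ≡⟨ ≡.cong (λ m → k + (m + s)) (ℕ.m+[n∸m]≡n c<n) ⟩
    k + (n + s)              ≡⟨ k+n+s≡1+2c ⟩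
    suc (c + c)              ∎))
    where
    regroup′ : ∀ c k r s → suc (c + (k + (r + s))) ≡ k + (suc c + r + s)
    regroup′ = solve-∀

lower : ℕ → ℕ → ℕ → Series
lower e zero n = 0ₛ
lower e (suc c) n = q^ (e + (n ∸ c)) ⊛ qbinom n c

-- Raising n in q^e [n, ⌊x/2⌋] leaves, depending on the parity of x, a remainder of one of
-- these two shapes; along the families of exponents below they cancel in consecutive pairs.
upper-part lower-part : Parity → ℕ → ℕ → ℕ → Series
upper-part 0ℙ e c n = 0ₛ
upper-part 1ℙ e c n = q^ (e + suc c) ⊛ qbinom n (suc c)
lower-part 0ℙ e c n = lower e c n
lower-part 1ℙ e c n = 0ₛ

upper-part-vanish : ∀ π e {c n} → n ≤ c → upper-part π e c n ≈ 0ₛ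
upper-part-vanish 0ℙ e n≤c = ≈-refl
upper-part-vanish 1ℙ e n≤c = ≈-trans (⊛-cong ≈-refl (qbinom-vanish (s≤s n≤c))) (⊛-zeroʳ _)

pascal-upper : ∀ e c n → q^ e ⊛ qbinom (suc n) (suc c) ⊕ q^ e ⊛ qbinom n c ≈ q^ (e + suc c) ⊛ qbinom n (suc c)
pascal-upper e c n = begin
  q^ e ⊛ (qbinom n c ⊕ q^ suc c ⊛ qbinom n (suc c)) ⊕ q^ e ⊛ qbinom n c
    ≈⟨ solve 3 (λ x a b → x :* (a :+ b) :+ x :* a := x :* b) ≈-refl (q^ e) (qbinom n c) _ ⟩
  q^ e ⊛ (q^ suc c ⊛ qbinom n (suc c))
    ≈⟨ q^-⊛-q^-⊛ e (suc c) _ ⟩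
  q^ (e + suc c) ⊛ qbinom n (suc c) ∎
  where open ≈-Reasoning

pascal-lower : ∀ e c n → q^ e ⊛ qbinom (suc n) c ⊕ q^ e ⊛ qbinom n c ≈ lower e c n
pascal-lower e zero n = begin
  q^ e ⊛ 1ₛ ⊕ q^ e ⊛ qbinom n 0  ≈⟨ ⊕-cong ≈-refl (⊛-cong ≈-refl (qbinom-0 n)) ⟩
  q^ e ⊛ 1ₛ ⊕ q^ e ⊛ 1ₛ          ≈⟨ ⊕-self _ ⟩
  0ₛ                             ∎
  where open ≈-Reasoning
pascal-lower e (suc c) n = begin
  q^ e ⊛ qbinom (suc n) (suc c) ⊕ q^ e ⊛ qbinom n (suc c)
    ≈⟨ ⊕-cong (⊛-cong ≈-refl (qbinom-suc′ n c)) ≈-refl ⟩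
  q^ e ⊛ (qbinom n (suc c) ⊕ q^ (n ∸ c) ⊛ qbinom n c) ⊕ q^ e ⊛ qbinom n (suc c)
    ≈⟨ solve 3 (λ x a b → x :* (a :+ b) :+ x :* a := x :* b) ≈-refl (q^ e) _ _ ⟩
  q^ e ⊛ (q^ (n ∸ c) ⊛ qbinom n c)
    ≈⟨ q^-⊛-q^-⊛ e (n ∸ c) _ ⟩
  q^ (e + (n ∸ c)) ⊛ qbinom n c ∎
  where open ≈-Reasoning

q^-⊛-qbinom-sym-cancel : ∀ k a b → q^ k ⊛ qbinom (a + b) a ⊕ q^ k ⊛ qbinom (a + b) b ≈ 0ₛ
q^-⊛-qbinom-sym-cancel k a b = ≈-trans (⊕-cong (⊛-cong ≈-refl (qbinom-sym a b)) ≈-refl) (⊕-self _)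

combine-families : ∀ {a₁ a₂ d₁ d₂ u₁ u₂ l₁ l₂} →
                   a₁ ⊕ d₁ ≈ u₁ ⊕ l₁ → a₂ ⊕ d₂ ≈ u₂ ⊕ l₂ → u₁ ≈ 0ₛ → u₂ ≈ 0ₛ → l₁ ⊕ l₂ ≈ 0ₛ →
                   a₁ ⊕ a₂ ≈ d₁ ⊕ d₂
combine-families {a₁} {a₂} {d₁} {d₂} {u₁} {u₂} {l₁} {l₂} step₁ step₂ u₁≈0 u₂≈0 l₁+l₂≈0 = begin
  a₁ ⊕ a₂
    ≈⟨ solve 4 (λ a₁ a₂ d₁ d₂ → a₁ :+ a₂ := (a₁ :+ d₁) :+ (a₂ :+ d₂) :+ (d₁ :+ d₂)) ≈-refl a₁ a₂ d₁ d₂ ⟩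
  (a₁ ⊕ d₁) ⊕ (a₂ ⊕ d₂) ⊕ (d₁ ⊕ d₂)
    ≈⟨ ⊕-cong (⊕-cong (≈-trans step₁ (⊕-cong u₁≈0 ≈-refl)) (≈-trans step₂ (⊕-cong u₂≈0 ≈-refl))) ≈-refl ⟩
  (0ₛ ⊕ l₁) ⊕ (0ₛ ⊕ l₂) ⊕ (d₁ ⊕ d₂)
    ≈⟨ solve 3 (λ l₁ l₂ d → (𝟘 :+ l₁) :+ (𝟘 :+ l₂) :+ d := (l₁ :+ l₂) :+ d) ≈-refl l₁ l₂ (d₁ ⊕ d₂) ⟩
  (l₁ ⊕ l₂) ⊕ (d₁ ⊕ d₂)
    ≈⟨ ⊕-cong l₁+l₂≈0 ≈-refl ⟩
  0ₛ ⊕ (d₁ ⊕ d₂)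
    ≈⟨ ⊕-identityˡ _ ⟩
  d₁ ⊕ d₂ ∎
  where open ≈-Reasoning

q^-⊛-q^-⊛-qbinom : ∀ a b {k n c} → (c ≤ n → a + b ≡ k) → q^ a ⊛ (q^ b ⊛ qbinom n c) ≈ q^ k ⊛ qbinom n c
q^-⊛-q^-⊛-qbinom a b {k} {n} {c} a+b≡k = ≈-trans (q^-⊛-q^-⊛ a b (qbinom n c)) (q^-⊛-qbinom-cong n c a+b≡k)

q^-⊛-lower : ∀ e c n → q^ e ⊛ lower 0 c n ≈ lower e c n
q^-⊛-lower e zero n = ⊛-zeroʳ (q^ e)
q^-⊛-lower e (suc c) n = q^-⊛-q^-⊛ e (n ∸ c) (qbinom n c)

-- Euler's pentagonal number theorem, finite form

-- Along the two families (s₀, e₀) = (1, 0) and (3, 1) we have 6 e₃ = s₃² − s₃, so the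
-- exponents e₃ run through the generalised pentagonal numbers.
s₃ : ℕ → ℕ → ℕ
s₃ s₀ zero = s₀
s₃ s₀ (suc m) = 3 + s₃ s₀ m

e₃ : ℕ → ℕ → ℕ → ℕ
e₃ s₀ e₀ zero = e₀
e₃ s₀ e₀ (suc m) = e₃ s₀ e₀ m + s₃ s₀ m + 1

s₃-≥ : ∀ s₀ m → m ≤ s₃ s₀ m
s₃-≥ s₀ zero = z≤n
s₃-≥ s₀ (suc m) = ℕ.≤-trans (s≤s (s₃-≥ s₀ m)) (ℕ.m≤n+m (suc (s₃ s₀ m)) 2)

s₀≤s₃ : ∀ s₀ m → s₀ ≤ s₃ s₀ m
s₀≤s₃ s₀ zero = ℕ.≤-refl
s₀≤s₃ s₀ (suc m) = ℕ.≤-trans (s₀≤s₃ s₀ m) (ℕ.m≤n+m (s₃ s₀ m) 3)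

euler-term : ℕ → ℕ → ℕ → ℕ → Series
euler-term s₀ e₀ n m = q^ e₃ s₀ e₀ m ⊛ qbinom n ⌊ n + s₃ s₀ m /2⌋

euler-upper euler-lower : ℕ → ℕ → ℕ → ℕ → Series
euler-upper s₀ e₀ n m = upper-part (parity (n + s₃ s₀ m)) (e₃ s₀ e₀ m) ⌊ n + s₃ s₀ m /2⌋ n
euler-lower s₀ e₀ n m = lower-part (parity (n + s₃ s₀ m)) (e₃ s₀ e₀ m) ⌊ n + s₃ s₀ m /2⌋ n

euler-local : ∀ e n x → q^ e ⊛ qbinom (suc n) ⌊ suc x /2⌋ ⊕ q^ e ⊛ qbinom n ⌊ x /2⌋
                        ≈ upper-part (parity x) e ⌊ x /2⌋ n ⊕ lower-part (parity x) e ⌊ x /2⌋ n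
euler-local e n x with parity x in π
... | 0ℙ rewrite ⌊suc/2⌋-even x π = ≈-trans (pascal-lower e ⌊ x /2⌋ n) (≈-sym (⊕-identityˡ _))
... | 1ℙ rewrite ⌊suc/2⌋-odd x π = ≈-trans (pascal-upper e ⌊ x /2⌋ n) (≈-sym (⊕-identityʳ _))

euler-lower-shift : ∀ e n s → lower-part (parity (n + (3 + s))) (e + s + 1) ⌊ n + (3 + s) /2⌋ n
                              ≈ upper-part (parity (n + s)) e ⌊ n + s /2⌋ n
euler-lower-shift e n s rewrite x∙yz≈y∙xz n 3 s | parity-suc (n + s) with parity (n + s) in π
... | 0ℙ = ≈-refl
... | 1ℙ rewrite ⌊suc/2⌋-odd (n + s) π =
  q^-⊛-qbinom-cong n (suc ⌊ n + s /2⌋) (shift-exponent e s 0 (odd⇒≡1+⌊/2⌋+⌊/2⌋ (n + s) π))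

euler-sum : ℕ → ℕ → ℕ → ℕ → Series
euler-sum s₀ e₀ n L = ∑[ m < L ] euler-term s₀ e₀ n m

euler-sum-step : ∀ s₀ e₀ n L → euler-sum s₀ e₀ (suc n) (suc L) ⊕ euler-sum s₀ e₀ n (suc L)
                               ≈ euler-upper s₀ e₀ n L ⊕ euler-lower s₀ e₀ n 0
euler-sum-step s₀ e₀ n L =
  ≈-trans (≈-sym (∑-distrib-⊕ (suc L) (euler-term s₀ e₀ (suc n)) (euler-term s₀ e₀ n)))
          (∑-telescope L (λ m → euler-local (e₃ s₀ e₀ m) n (n + s₃ s₀ m))
                         (λ m → euler-lower-shift (e₃ s₀ e₀ m) n (s₃ s₀ m)))

euler-upper-vanish : ∀ s₀ e₀ {n L} → n ≤ L → euler-upper s₀ e₀ n L ≈ 0ₛ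
euler-upper-vanish s₀ e₀ {n} {L} n≤L =
  upper-part-vanish (parity (n + s₃ s₀ L)) (e₃ s₀ e₀ L) (n≤⌊x/2⌋ (ℕ.+-monoʳ-≤ n (ℕ.≤-trans n≤L (s₃-≥ s₀ L))))

euler-boundary : ∀ n → euler-lower 1 0 n 0 ⊕ euler-lower 3 1 n 0 ≈ 0ₛ
euler-boundary n rewrite ℕ.+-comm n 1 | ℕ.+-comm n 3 | parity-suc n with parity n in π
... | 0ℙ = ⊕-identityˡ 0ₛ
... | 1ℙ rewrite ⌊suc/2⌋-odd n π = cancel ⌊ n /2⌋ (odd⇒≡1+⌊/2⌋+⌊/2⌋ n π)
  where
  cancel : ∀ p → n ≡ suc (p + p) → lower 0 (suc p) n ⊕ lower 1 (suc (suc p)) n ≈ 0ₛ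
  cancel p refl = begin
    q^ (suc (p + p) ∸ p) ⊛ qbinom (suc (p + p)) p ⊕ q^ suc (p + p ∸ p) ⊛ qbinom (suc (p + p)) (suc p)
      ≈⟨ ⊕-cong (⊛-cong (≈-reflexive (≡.cong q^_ 1+2p∸p≡1+p)) ≈-refl)
                (⊛-cong (≈-reflexive (≡.cong (λ k → q^ suc k) (ℕ.m+n∸m≡n p p))) ≈-refl) ⟩
    q^ suc p ⊛ qbinom (suc (p + p)) p ⊕ q^ suc p ⊛ qbinom (suc (p + p)) (suc p)
      ≡⟨ ≡.cong (λ N → q^ suc p ⊛ qbinom N p ⊕ q^ suc p ⊛ qbinom N (suc p)) 1+2p≡p+1+p ⟩
    q^ suc p ⊛ qbinom (p + suc p) p ⊕ q^ suc p ⊛ qbinom (p + suc p) (suc p)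
      ≈⟨ q^-⊛-qbinom-sym-cancel (suc p) p (suc p) ⟩
    0ₛ ∎
    where
    open ≈-Reasoning
    1+2p≡p+1+p : suc (p + p) ≡ p + suc p
    1+2p≡p+1+p = ≡.sym (ℕ.+-suc p p)
    1+2p∸p≡1+p : suc (p + p) ∸ p ≡ suc p
    1+2p∸p≡1+p = ≡.trans (≡.cong (_∸ p) 1+2p≡p+1+p) (ℕ.m+n∸m≡n p (suc p))

euler-poly : ℕ → ℕ → Series
euler-poly n L = euler-sum 1 0 n L ⊕ euler-sum 3 1 n L

euler-poly-suc : ∀ {n L} → n ≤ L → euler-poly (suc n) (suc L) ≈ euler-poly n (suc L)
euler-poly-suc {n} {L} n≤L =
  combine-families (euler-sum-step 1 0 n L) (euler-sum-step 3 1 n L)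
                   (euler-upper-vanish 1 0 n≤L) (euler-upper-vanish 3 1 n≤L) (euler-boundary n)

euler-poly-0 : ∀ L → euler-poly 0 (suc L) ≈ 1ₛ
euler-poly-0 L = begin
  (euler-term 1 0 0 0 ⊕ ∑[ m < L ] euler-term 1 0 0 (suc m)) ⊕ euler-sum 3 1 0 (suc L)
    ≈⟨ ⊕-cong (⊕-cong ≈-refl (∑-zero L λ m _ → q^-⊛-qbinom-⌊/2⌋-vanish (e₃ 1 0 (suc m)) 0 (s₃ 1 (suc m)) (s≤s (s≤s z≤n))))
              (∑-zero (suc L) λ m _ → q^-⊛-qbinom-⌊/2⌋-vanish (e₃ 3 1 m) 0 (s₃ 3 m) (ℕ.≤-trans (ℕ.n≤1+n 2) (s₀≤s₃ 3 m))) ⟩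
  (1ₛ ⊛ 1ₛ ⊕ 0ₛ) ⊕ 0ₛ
    ≈⟨ solve 0 ((𝟙 :* 𝟙 :+ 𝟘) :+ 𝟘 := 𝟙) ≈-refl ⟩
  1ₛ ∎
  where open ≈-Reasoning

euler-poly≈1 : ∀ {n L} → n ≤ L → euler-poly n (suc L) ≈ 1ₛ
euler-poly≈1 {zero} {L} _ = euler-poly-0 L
euler-poly≈1 {suc n} {L} n<L = ≈-trans (euler-poly-suc (ℕ.<⇒≤ n<L)) (euler-poly≈1 (ℕ.<⇒≤ n<L))

-- The first Rogers–Ramanujan identity, in Schur's finite form

qbinom-three-term-upper : ∀ c n → qbinom (suc (suc n)) (suc c) ⊕ qbinom (suc n) c ⊕ q^ suc n ⊛ qbinom n c
                                  ≈ q^ suc c ⊛ qbinom n (suc c)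
qbinom-three-term-upper c n = begin
  (qbinom (suc n) c ⊕ q^ suc c ⊛ qbinom (suc n) (suc c)) ⊕ qbinom (suc n) c ⊕ q^ suc n ⊛ qbinom n c
    ≈⟨ ⊕-cong (⊕-cong (⊕-cong ≈-refl (⊛-cong ≈-refl (qbinom-suc′ n c))) ≈-refl) ≈-refl ⟩
  (qbinom (suc n) c ⊕ q^ suc c ⊛ (qbinom n (suc c) ⊕ q^ (n ∸ c) ⊛ qbinom n c)) ⊕ qbinom (suc n) c ⊕ q^ suc n ⊛ qbinom n c
    ≈⟨ solve 5 (λ a u b v w → (a :+ u :* (b :+ v)) :+ a :+ w := u :* b :+ (u :* v :+ w)) ≈-refl
             (qbinom (suc n) c) (q^ suc c) (qbinom n (suc c)) (q^ (n ∸ c) ⊛ qbinom n c) (q^ suc n ⊛ qbinom n c) ⟩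
  q^ suc c ⊛ qbinom n (suc c) ⊕ (q^ suc c ⊛ (q^ (n ∸ c) ⊛ qbinom n c) ⊕ q^ suc n ⊛ qbinom n c)
    ≈⟨ ⊕-cong ≈-refl (⊕-cong (q^-⊛-q^-⊛-qbinom (suc c) (n ∸ c) (λ c≤n → ≡.cong suc (ℕ.m+[n∸m]≡n c≤n))) ≈-refl) ⟩
  q^ suc c ⊛ qbinom n (suc c) ⊕ (q^ suc n ⊛ qbinom n c ⊕ q^ suc n ⊛ qbinom n c)
    ≈⟨ ⊕-cong ≈-refl (⊕-self _) ⟩
  q^ suc c ⊛ qbinom n (suc c) ⊕ 0ₛ
    ≈⟨ ⊕-identityʳ _ ⟩
  q^ suc c ⊛ qbinom n (suc c) ∎
  where open ≈-Reasoning

qbinom-three-term-lower : ∀ c n → qbinom (suc (suc n)) (suc c) ⊕ qbinom (suc n) (suc c) ⊕ q^ suc n ⊛ qbinom n c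
                                  ≈ lower 0 c n
qbinom-three-term-lower zero n = begin
  qbinom (suc (suc n)) 1 ⊕ qbinom (suc n) 1 ⊕ q^ suc n ⊛ qbinom n 0
    ≈⟨ ⊕-cong (⊕-cong (qbinom-suc′ (suc n) 0) ≈-refl) (⊛-cong ≈-refl (qbinom-0 n)) ⟩
  (qbinom (suc n) 1 ⊕ q^ suc n ⊛ 1ₛ) ⊕ qbinom (suc n) 1 ⊕ q^ suc n ⊛ 1ₛ
    ≈⟨ solve 2 (λ a u → (a :+ u :* 𝟙) :+ a :+ u :* 𝟙 := 𝟘) ≈-refl (qbinom (suc n) 1) (q^ suc n) ⟩
  0ₛ ∎
  where open ≈-Reasoning
qbinom-three-term-lower (suc c) n = begin
  qbinom (suc (suc n)) (suc (suc c)) ⊕ qbinom (suc n) (suc (suc c)) ⊕ q^ suc n ⊛ qbinom n (suc c)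
    ≈⟨ ⊕-cong (⊕-cong (qbinom-suc′ (suc n) (suc c)) ≈-refl) ≈-refl ⟩
  (qbinom (suc n) (suc (suc c)) ⊕ q^ (n ∸ c) ⊛ (qbinom n c ⊕ q^ suc c ⊛ qbinom n (suc c)))
    ⊕ qbinom (suc n) (suc (suc c)) ⊕ q^ suc n ⊛ qbinom n (suc c)
    ≈⟨ solve 5 (λ a u b v w → (a :+ u :* (b :+ v)) :+ a :+ w := u :* b :+ (u :* v :+ w)) ≈-refl
             (qbinom (suc n) (suc (suc c))) (q^ (n ∸ c)) (qbinom n c)
             (q^ suc c ⊛ qbinom n (suc c)) (q^ suc n ⊛ qbinom n (suc c)) ⟩
  q^ (n ∸ c) ⊛ qbinom n c ⊕ (q^ (n ∸ c) ⊛ (q^ suc c ⊛ qbinom n (suc c)) ⊕ q^ suc n ⊛ qbinom n (suc c))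
    ≈⟨ ⊕-cong ≈-refl (⊕-cong (q^-⊛-q^-⊛-qbinom (n ∸ c) (suc c) exponent) ≈-refl) ⟩
  q^ (n ∸ c) ⊛ qbinom n c ⊕ (q^ suc n ⊛ qbinom n (suc c) ⊕ q^ suc n ⊛ qbinom n (suc c))
    ≈⟨ ⊕-cong ≈-refl (⊕-self _) ⟩
  q^ (n ∸ c) ⊛ qbinom n c ⊕ 0ₛ
    ≈⟨ ⊕-identityʳ _ ⟩
  q^ (n ∸ c) ⊛ qbinom n c ∎
  where
  open ≈-Reasoning
  exponent : suc c ≤ n → n ∸ c + suc c ≡ suc n
  exponent c<n = ≡.trans (ℕ.+-suc (n ∸ c) c) (≡.cong suc (ℕ.m∸n+n≡m (ℕ.<⇒≤ c<n)))

common-factor : ∀ x a b y d → x ⊛ a ⊕ x ⊛ b ⊕ y ⊛ (x ⊛ d) ≈ x ⊛ (a ⊕ b ⊕ y ⊛ d)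
common-factor = solve 5 (λ x a b y d → x :* a :+ x :* b :+ y :* (x :* d) := x :* (a :+ b :+ y :* d)) ≈-refl

-- Along the two families (s₀, e₀) = (1, 0) and (5, 2) we have 10 e₅ = s₅² − s₅, so the
-- exponents e₅ run through the numbers k(5k + 1)/2, k ∈ ℤ, of the Rogers–Ramanujan theta series.
s₅ : ℕ → ℕ → ℕ
s₅ s₀ zero = s₀
s₅ s₀ (suc m) = 5 + s₅ s₀ m

e₅ : ℕ → ℕ → ℕ → ℕ
e₅ s₀ e₀ zero = e₀
e₅ s₀ e₀ (suc m) = e₅ s₀ e₀ m + s₅ s₀ m + 2

s₅-≥ : ∀ s₀ m → m ≤ s₅ s₀ m
s₅-≥ s₀ zero = z≤n
s₅-≥ s₀ (suc m) = ℕ.≤-trans (s≤s (s₅-≥ s₀ m)) (ℕ.m≤n+m (suc (s₅ s₀ m)) 4)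

s₀≤s₅ : ∀ s₀ m → s₀ ≤ s₅ s₀ m
s₀≤s₅ s₀ zero = ℕ.≤-refl
s₀≤s₅ s₀ (suc m) = ℕ.≤-trans (s₀≤s₅ s₀ m) (ℕ.m≤n+m (s₅ s₀ m) 5)

rr-term : ℕ → ℕ → ℕ → ℕ → Series
rr-term s₀ e₀ n m = q^ e₅ s₀ e₀ m ⊛ qbinom n ⌊ n + s₅ s₀ m /2⌋

rr-upper rr-lower : ℕ → ℕ → ℕ → ℕ → Series
rr-upper s₀ e₀ n m = upper-part (parity (suc (n + s₅ s₀ m))) (e₅ s₀ e₀ m) ⌊ n + s₅ s₀ m /2⌋ n
rr-lower s₀ e₀ n m = lower-part (parity (suc (n + s₅ s₀ m))) (e₅ s₀ e₀ m) ⌊ n + s₅ s₀ m /2⌋ n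

rr-local : ∀ e n x → q^ e ⊛ qbinom (suc (suc n)) (suc ⌊ x /2⌋) ⊕ q^ e ⊛ qbinom (suc n) ⌊ suc x /2⌋
                       ⊕ q^ suc n ⊛ (q^ e ⊛ qbinom n ⌊ x /2⌋)
                     ≈ upper-part (parity (suc x)) e ⌊ x /2⌋ n ⊕ lower-part (parity (suc x)) e ⌊ x /2⌋ n
rr-local e n x rewrite parity-suc x with parity x in π
... | 0ℙ rewrite ⌊suc/2⌋-even x π = begin
  q^ e ⊛ qbinom (suc (suc n)) (suc c) ⊕ q^ e ⊛ qbinom (suc n) c ⊕ q^ suc n ⊛ (q^ e ⊛ qbinom n c)
    ≈⟨ common-factor (q^ e) _ _ (q^ suc n) _ ⟩
  q^ e ⊛ (qbinom (suc (suc n)) (suc c) ⊕ qbinom (suc n) c ⊕ q^ suc n ⊛ qbinom n c)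
    ≈⟨ ⊛-cong ≈-refl (qbinom-three-term-upper c n) ⟩
  q^ e ⊛ (q^ suc c ⊛ qbinom n (suc c))
    ≈⟨ q^-⊛-q^-⊛ e (suc c) _ ⟩
  q^ (e + suc c) ⊛ qbinom n (suc c)
    ≈⟨ ⊕-identityʳ _ ⟨
  q^ (e + suc c) ⊛ qbinom n (suc c) ⊕ 0ₛ ∎
  where
  open ≈-Reasoning
  c : ℕ
  c = ⌊ x /2⌋
... | 1ℙ rewrite ⌊suc/2⌋-odd x π = begin
  q^ e ⊛ qbinom (suc (suc n)) (suc c) ⊕ q^ e ⊛ qbinom (suc n) (suc c) ⊕ q^ suc n ⊛ (q^ e ⊛ qbinom n c)
    ≈⟨ common-factor (q^ e) _ _ (q^ suc n) _ ⟩
  q^ e ⊛ (qbinom (suc (suc n)) (suc c) ⊕ qbinom (suc n) (suc c) ⊕ q^ suc n ⊛ qbinom n c)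
    ≈⟨ ⊛-cong ≈-refl (qbinom-three-term-lower c n) ⟩
  q^ e ⊛ lower 0 c n
    ≈⟨ q^-⊛-lower e c n ⟩
  lower e c n
    ≈⟨ ⊕-identityˡ _ ⟨
  0ₛ ⊕ lower e c n ∎
  where
  open ≈-Reasoning
  c : ℕ
  c = ⌊ x /2⌋

rr-lower-shift : ∀ e n s → lower-part (parity (suc (n + (5 + s)))) (e + s + 2) ⌊ n + (5 + s) /2⌋ n
                           ≈ upper-part (parity (suc (n + s))) e ⌊ n + s /2⌋ n
rr-lower-shift e n s rewrite x∙yz≈y∙xz n 5 s | parity-suc (n + s) with parity (n + s) in π
... | 1ℙ = ≈-refl
... | 0ℙ rewrite ⌊suc/2⌋-even (n + s) π =
  q^-⊛-qbinom-cong n (suc ⌊ n + s /2⌋) (shift-exponent e s 1 (≡.cong suc (even⇒≡⌊/2⌋+⌊/2⌋ (n + s) π)))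

rr-sum : ℕ → ℕ → ℕ → ℕ → Series
rr-sum s₀ e₀ n L = ∑[ m < L ] rr-term s₀ e₀ n m

rr-sum-step : ∀ s₀ e₀ n L →
              rr-sum s₀ e₀ (suc (suc n)) (suc L) ⊕ (rr-sum s₀ e₀ (suc n) (suc L) ⊕ q^ suc n ⊛ rr-sum s₀ e₀ n (suc L))
              ≈ rr-upper s₀ e₀ n L ⊕ rr-lower s₀ e₀ n 0
rr-sum-step s₀ e₀ n L = begin
  ∑ (suc L) T″ ⊕ (∑ (suc L) T′ ⊕ q^ suc n ⊛ ∑ (suc L) T)
    ≈⟨ ⊕-cong ≈-refl (⊕-cong ≈-refl (⊛-distribˡ-∑ (suc L) (q^ suc n) T)) ⟩
  ∑ (suc L) T″ ⊕ (∑ (suc L) T′ ⊕ ∑[ m < suc L ] (q^ suc n ⊛ T m))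
    ≈⟨ ⊕-assoc _ _ _ ⟨
  ∑ (suc L) T″ ⊕ ∑ (suc L) T′ ⊕ ∑[ m < suc L ] (q^ suc n ⊛ T m)
    ≈⟨ ⊕-cong (∑-distrib-⊕ (suc L) T″ T′) ≈-refl ⟨
  ∑[ m < suc L ] (T″ m ⊕ T′ m) ⊕ ∑[ m < suc L ] (q^ suc n ⊛ T m)
    ≈⟨ ∑-distrib-⊕ (suc L) (λ m → T″ m ⊕ T′ m) (λ m → q^ suc n ⊛ T m) ⟨
  ∑[ m < suc L ] (T″ m ⊕ T′ m ⊕ q^ suc n ⊛ T m)
    ≈⟨ ∑-telescope L (λ m → rr-local (e₅ s₀ e₀ m) n (n + s₅ s₀ m)) (λ m → rr-lower-shift (e₅ s₀ e₀ m) n (s₅ s₀ m)) ⟩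
  rr-upper s₀ e₀ n L ⊕ rr-lower s₀ e₀ n 0 ∎
  where
  open ≈-Reasoning
  T″ T′ T : ℕ → Series
  T″ = rr-term s₀ e₀ (suc (suc n))
  T′ = rr-term s₀ e₀ (suc n)
  T = rr-term s₀ e₀ n

rr-upper-vanish : ∀ s₀ e₀ {n L} → n ≤ L → rr-upper s₀ e₀ n L ≈ 0ₛ
rr-upper-vanish s₀ e₀ {n} {L} n≤L =
  upper-part-vanish (parity (suc (n + s₅ s₀ L))) (e₅ s₀ e₀ L) (n≤⌊x/2⌋ (ℕ.+-monoʳ-≤ n (ℕ.≤-trans n≤L (s₅-≥ s₀ L))))

rr-boundary : ∀ n → rr-lower 1 0 n 0 ⊕ rr-lower 5 2 n 0 ≈ 0ₛ
rr-boundary n rewrite ℕ.+-comm n 1 | ℕ.+-comm n 5 with parity n in π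
... | 1ℙ = ⊕-identityˡ 0ₛ
... | 0ℙ rewrite ⌊suc/2⌋-even n π = cancel ⌊ n /2⌋ (even⇒≡⌊/2⌋+⌊/2⌋ n π)
  where
  cancel : ∀ p → n ≡ p + p → lower 0 p n ⊕ lower 2 (suc (suc p)) n ≈ 0ₛ
  cancel zero refl = ≈-trans (⊕-identityˡ (q^ 2 ⊛ qbinom 0 1))
                             (≈-trans (⊛-cong ≈-refl (qbinom-vanish {0} {1} (s≤s z≤n))) (⊛-zeroʳ (q^ 2)))
  cancel (suc p) refl = begin
    q^ (2p+2 ∸ p) ⊛ qbinom 2p+2 p ⊕ q^ (2 + (2p+2 ∸ suc (suc p))) ⊛ qbinom 2p+2 (suc (suc p))
      ≈⟨ ⊕-cong (⊛-cong (≈-reflexive (≡.cong q^_ 2p+2∸p≡p+2)) ≈-refl)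
                (⊛-cong (≈-reflexive (≡.cong (λ k → q^ (2 + k)) 2p+2∸[p+2]≡p)) ≈-refl) ⟩
    q^ (2 + p) ⊛ qbinom 2p+2 p ⊕ q^ (2 + p) ⊛ qbinom 2p+2 (suc (suc p))
      ≡⟨ ≡.cong (λ N → q^ (2 + p) ⊛ qbinom N p ⊕ q^ (2 + p) ⊛ qbinom N (suc (suc p))) 2p+2≡p+[p+2] ⟩
    q^ (2 + p) ⊛ qbinom (p + suc (suc p)) p ⊕ q^ (2 + p) ⊛ qbinom (p + suc (suc p)) (suc (suc p))
      ≈⟨ q^-⊛-qbinom-sym-cancel (2 + p) p (suc (suc p)) ⟩
    0ₛ ∎
    where
    open ≈-Reasoning
    2p+2 : ℕ
    2p+2 = suc p + suc p
    2p+2≡p+[p+2] : 2p+2 ≡ p + suc (suc p)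
    2p+2≡p+[p+2] = ≡.sym (ℕ.+-suc p (suc p))
    2p+2∸p≡p+2 : 2p+2 ∸ p ≡ 2 + p
    2p+2∸p≡p+2 = ≡.trans (≡.cong (_∸ p) 2p+2≡p+[p+2]) (ℕ.m+n∸m≡n p (suc (suc p)))
    2p+2∸[p+2]≡p : 2p+2 ∸ suc (suc p) ≡ p
    2p+2∸[p+2]≡p = ≡.trans (≡.cong (_∸ suc (suc p)) (≡.trans 2p+2≡p+[p+2] (ℕ.+-comm p (suc (suc p)))))
                           (ℕ.m+n∸m≡n (suc (suc p)) p)

rr-poly : ℕ → ℕ → Series
rr-poly n L = rr-sum 1 0 n L ⊕ rr-sum 5 2 n L

rr-poly-step : ∀ {n L} → n ≤ L → rr-poly (suc (suc n)) (suc L) ≈ rr-poly (suc n) (suc L) ⊕ q^ suc n ⊛ rr-poly n (suc L)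
rr-poly-step {n} {L} n≤L =
  ≈-trans (combine-families (rr-sum-step 1 0 n L) (rr-sum-step 5 2 n L)
                            (rr-upper-vanish 1 0 n≤L) (rr-upper-vanish 5 2 n≤L) (rr-boundary n))
          (solve 5 (λ x a′ a b′ b → (a′ :+ x :* a) :+ (b′ :+ x :* b) := (a′ :+ b′) :+ x :* (a :+ b)) ≈-refl
                 (q^ suc n) (rr-sum 1 0 (suc n) (suc L)) (rr-sum 1 0 n (suc L))
                 (rr-sum 5 2 (suc n) (suc L)) (rr-sum 5 2 n (suc L)))

rr-poly-initial : ∀ {n} L → n ≤ 1 → rr-poly n (suc L) ≈ rr-term 1 0 n 0
rr-poly-initial {n} L n≤1 = begin
  (rr-term 1 0 n 0 ⊕ ∑[ m < L ] rr-term 1 0 n (suc m)) ⊕ rr-sum 5 2 n (suc L)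
    ≈⟨ ⊕-cong (⊕-cong ≈-refl (∑-zero L λ m _ →
                 q^-⊛-qbinom-⌊/2⌋-vanish (e₅ 1 0 (suc m)) n (s₅ 1 (suc m)) (2+n≤ (s≤s (s≤s (s≤s z≤n))))))
              (∑-zero (suc L) λ m _ →
                 q^-⊛-qbinom-⌊/2⌋-vanish (e₅ 5 2 m) n (s₅ 5 m) (2+n≤ (ℕ.≤-trans (ℕ.m≤n+m 3 2) (s₀≤s₅ 5 m)))) ⟩
  (rr-term 1 0 n 0 ⊕ 0ₛ) ⊕ 0ₛ
    ≈⟨ ≈-trans (⊕-identityʳ _) (⊕-identityʳ _) ⟩
  rr-term 1 0 n 0 ∎
  where
  open ≈-Reasoning
  2+n≤ : ∀ {s} → 3 ≤ s → suc (suc n) ≤ s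
  2+n≤ = ℕ.≤-trans (s≤s (s≤s n≤1))

schur-term : ℕ → ℕ → Series
schur-term n j = q^ (j * j) ⊛ qbinom (n ∸ j) j

schur-D : ℕ → Series
schur-D n = ∑[ j < suc n ] schur-term n j

[1+i]²+[n∸i∸i]≡1+n+i² : ∀ {n i} → i ≤ n → i ≤ n ∸ i → suc i * suc i + (n ∸ i ∸ i) ≡ suc n + i * i
[1+i]²+[n∸i∸i]≡1+n+i² {n} {i} i≤n i≤n∸i = begin
  suc i * suc i + (n ∸ i ∸ i)         ≡⟨ square-suc i (n ∸ i ∸ i) ⟩
  suc (i + (i + (n ∸ i ∸ i))) + i * i ≡⟨ ≡.cong (λ z → suc (i + z) + i * i) (ℕ.m+[n∸m]≡n i≤n∸i) ⟩
  suc (i + (n ∸ i)) + i * i           ≡⟨ ≡.cong (λ z → suc z + i * i) (ℕ.m+[n∸m]≡n i≤n) ⟩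
  suc n + i * i                       ∎
  where
  open ≡.≡-Reasoning
  square-suc : ∀ i r → suc i * suc i + r ≡ suc (i + (i + r)) + i * i
  square-suc = solve-∀

schur-term-step : ∀ {n i} → i ≤ n → schur-term (suc (suc n)) (suc i) ≈ schur-term (suc n) (suc i) ⊕ q^ suc n ⊛ schur-term n i
schur-term-step {n} {i} i≤n = begin
  q^ (suc i * suc i) ⊛ qbinom (suc n ∸ i) (suc i)
    ≡⟨ ≡.cong (λ k → q^ (suc i * suc i) ⊛ qbinom k (suc i)) (ℕ.+-∸-assoc 1 i≤n) ⟩
  q^ (suc i * suc i) ⊛ qbinom (suc (n ∸ i)) (suc i)
    ≈⟨ ⊛-cong ≈-refl (qbinom-suc′ (n ∸ i) i) ⟩
  q^ (suc i * suc i) ⊛ (qbinom (n ∸ i) (suc i) ⊕ q^ (n ∸ i ∸ i) ⊛ qbinom (n ∸ i) i)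
    ≈⟨ ⊛-distribˡ (q^ (suc i * suc i)) _ _ ⟩
  q^ (suc i * suc i) ⊛ qbinom (n ∸ i) (suc i) ⊕ q^ (suc i * suc i) ⊛ (q^ (n ∸ i ∸ i) ⊛ qbinom (n ∸ i) i)
    ≈⟨ ⊕-cong ≈-refl (≈-trans (q^-⊛-q^-⊛-qbinom (suc i * suc i) (n ∸ i ∸ i) ([1+i]²+[n∸i∸i]≡1+n+i² i≤n))
                              (≈-sym (q^-⊛-q^-⊛ (suc n) (i * i) _))) ⟩
  q^ (suc i * suc i) ⊛ qbinom (n ∸ i) (suc i) ⊕ q^ suc n ⊛ (q^ (i * i) ⊛ qbinom (n ∸ i) i) ∎
  where open ≈-Reasoning

schur-D-step : ∀ n → schur-D (suc (suc n)) ≈ schur-D (suc n) ⊕ q^ suc n ⊛ schur-D n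
schur-D-step n = begin
  D₀ ⊕ ∑[ i < suc (suc n) ] schur-term (suc (suc n)) (suc i)
    ≈⟨ ⊕-cong ≈-refl (∑-snoc (suc n) (λ i → schur-term (suc (suc n)) (suc i))) ⟩
  D₀ ⊕ (∑[ i < suc n ] schur-term (suc (suc n)) (suc i) ⊕ schur-term (suc (suc n)) (suc (suc n)))
    ≈⟨ ⊕-cong ≈-refl (⊕-cong (∑-cong (suc n) λ i i<1+n → schur-term-step (ℕ.≤-pred i<1+n)) last-vanishes) ⟩
  D₀ ⊕ (∑[ i < suc n ] (schur-term (suc n) (suc i) ⊕ q^ suc n ⊛ schur-term n i) ⊕ 0ₛ)
    ≈⟨ ⊕-cong ≈-refl (≈-trans (⊕-identityʳ _)
         (∑-distrib-⊕ (suc n) (λ i → schur-term (suc n) (suc i)) (λ i → q^ suc n ⊛ schur-term n i))) ⟩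
  D₀ ⊕ (∑[ i < suc n ] schur-term (suc n) (suc i) ⊕ ∑[ i < suc n ] (q^ suc n ⊛ schur-term n i))
    ≈⟨ ⊕-cong ≈-refl (⊕-cong ≈-refl (⊛-distribˡ-∑ (suc n) (q^ suc n) (schur-term n))) ⟨
  D₀ ⊕ (∑[ i < suc n ] schur-term (suc n) (suc i) ⊕ q^ suc n ⊛ schur-D n)
    ≈⟨ ⊕-assoc _ _ _ ⟨
  schur-D (suc n) ⊕ q^ suc n ⊛ schur-D n ∎
  where
  open ≈-Reasoning
  D₀ : Series
  D₀ = schur-term (suc (suc n)) 0
  last-vanishes : schur-term (suc (suc n)) (suc (suc n)) ≈ 0ₛ
  last-vanishes = ≈-trans (⊛-cong ≈-refl (qbinom-vanish (s≤s (ℕ.≤-trans (ℕ.m∸n≤m n n) (ℕ.n≤1+n n))))) (⊛-zeroʳ _)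

schur-D≈rr-poly : ∀ {n L} → n ≤ L → schur-D n ≈ rr-poly n (suc L)
schur-D≈rr-poly {zero} {L} _ = ≈-trans (⊕-identityʳ _) (≈-sym (rr-poly-initial L z≤n))
schur-D≈rr-poly {suc zero} {L} 1≤L = ≈-trans D₁≈ (≈-sym (rr-poly-initial L (s≤s z≤n)))
  where
  D₁≈ : schur-D 1 ≈ rr-term 1 0 1 0
  D₁≈ = solve 2 (λ x y → x :* 𝟙 :+ (y :* 𝟘 :+ 𝟘) := x :* (𝟙 :+ y :* 𝟘)) ≈-refl (q^ 0) (q^ 1)
schur-D≈rr-poly {suc (suc n)} {L} 2+n≤L = begin
  schur-D (suc (suc n))
    ≈⟨ schur-D-step n ⟩
  schur-D (suc n) ⊕ q^ suc n ⊛ schur-D n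
    ≈⟨ ⊕-cong (schur-D≈rr-poly 1+n≤L) (⊛-cong ≈-refl (schur-D≈rr-poly n≤L)) ⟩
  rr-poly (suc n) (suc L) ⊕ q^ suc n ⊛ rr-poly n (suc L)
    ≈⟨ rr-poly-step n≤L ⟨
  rr-poly (suc (suc n)) (suc L)                            ∎
  where
  open ≈-Reasoning
  1+n≤L : suc n ≤ L
  1+n≤L = ℕ.<⇒≤ 2+n≤L
  n≤L : n ≤ L
  n≤L = ℕ.<⇒≤ 1+n≤L

-- Letting n tend to infinity modulo q^{N+1}

poch-≈[]-poch : ∀ {N c} → N ≤ c → poch 0 c ≈[ suc N ] poch 0 N
poch-≈[]-poch {N} {c} N≤c =
  ≡.subst (λ k → poch 0 k ≈[ suc N ] poch 0 N) (ℕ.m+[n∸m]≡n N≤c) (poch-+-≈[] 0 N (c ∸ N) ℕ.≤-refl)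

poch-⊛-qbinom-≈[]-1 : ∀ {N c b} → N ≤ c → N ≤ b → poch 0 N ⊛ qbinom (c + b) c ≈[ suc N ] 1ₛ
poch-⊛-qbinom-≈[]-1 {N} {c} {b} N≤c N≤b = begin
  poch 0 N ⊛ qbinom (c + b) c   ≈⟨ ⊛-cong-≈[] (≈[]-sym (poch-≈[]-poch N≤c)) ≈[]-refl ⟩
  poch 0 c ⊛ qbinom (c + b) c   ≈⟨ ≈⇒≈[] (≈-trans (⊛-comm _ _) (qbinom-⊛-poch c b)) ⟩
  poch b c                      ≈⟨ poch-≈[]-1 b c (s≤s N≤b) ⟩
  1ₛ                            ∎
  where open ≈[]-Reasoning (suc N)

poch-⊛-q^-⊛-qbinom : ∀ {N} e {n c} → (e ≤ N → N ≤ c × N + c ≤ n) → poch 0 N ⊛ (q^ e ⊛ qbinom n c) ≈[ suc N ] q^ e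
poch-⊛-q^-⊛-qbinom {N} e {n} {c} bounds with ℕ.≤-<-connex e N
... | inj₂ N<e = begin
  poch 0 N ⊛ (q^ e ⊛ qbinom n c)   ≈⟨ ≈⇒≈[] (⊛-left-comm (poch 0 N) (q^ e) _) ⟩
  q^ e ⊛ (poch 0 N ⊛ qbinom n c)   ≈⟨ q^-⊛-≈[]-0 _ N<e ⟩
  0ₛ                               ≈⟨ q^-≈[]-0 N<e ⟨
  q^ e                             ∎
  where open ≈[]-Reasoning (suc N)
... | inj₁ e≤N with bounds e≤N
...   | N≤c , N+c≤n = begin
  poch 0 N ⊛ (q^ e ⊛ qbinom n c)
    ≈⟨ ≈⇒≈[] (⊛-left-comm (poch 0 N) (q^ e) _) ⟩
  q^ e ⊛ (poch 0 N ⊛ qbinom n c)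
    ≡⟨ ≡.cong (λ k → q^ e ⊛ (poch 0 N ⊛ qbinom k c)) (≡.sym (ℕ.m+[n∸m]≡n c≤n)) ⟩
  q^ e ⊛ (poch 0 N ⊛ qbinom (c + (n ∸ c)) c)
    ≈⟨ ⊛-cong-≈[] ≈[]-refl (poch-⊛-qbinom-≈[]-1 N≤c (ℕ.m+n≤o⇒m≤o∸n N N+c≤n)) ⟩
  q^ e ⊛ 1ₛ
    ≈⟨ ≈⇒≈[] (⊛-identityʳ (q^ e)) ⟩
  q^ e                                      ∎
  where
  open ≈[]-Reasoning (suc N)
  c≤n : c ≤ n
  c≤n = ℕ.m+n≤o⇒n≤o N N+c≤n

-- Any n₀ ≥ 7N + 5 would do: the terms that matter below degree N + 1 have s ≤ 5N + 5.
n₀ : ℕ → ℕ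
n₀ N = 8 * N + 8

⌊n₀+s/2⌋-bounds : ∀ N {s} → s ≤ 5 + 5 * N → N ≤ ⌊ n₀ N + s /2⌋ × N + ⌊ n₀ N + s /2⌋ ≤ n₀ N
⌊n₀+s/2⌋-bounds N {s} s≤5+5N = N≤c , N+c≤n₀
  where
  c : ℕ
  c = ⌊ n₀ N + s /2⌋
  N≤c : N ≤ c
  N≤c = n≤⌊x/2⌋ (ℕ.≤-trans (ℕ.≤-trans (ℕ.m≤m+n (N + N) (6 * N + 8)) (ℕ.≤-reflexive (2N+6N+8≡n₀ N)))
                          (ℕ.m≤m+n (n₀ N) s))
    where
    2N+6N+8≡n₀ : ∀ N → N + N + (6 * N + 8) ≡ 8 * N + 8
    2N+6N+8≡n₀ = solve-∀
  c≤7N+8 : c ≤ 7 * N + 8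
  c≤7N+8 = ℕ.≤-trans (ℕ.⌊n/2⌋-mono n₀+s≤) (ℕ.≤-reflexive (≡.sym (ℕ.n≡⌊n+n/2⌋ (7 * N + 8))))
    where
    slack : ∀ N → 8 * N + 8 + (5 + 5 * N) + (N + 3) ≡ (7 * N + 8) + (7 * N + 8)
    slack = solve-∀
    n₀+s≤ : n₀ N + s ≤ (7 * N + 8) + (7 * N + 8)
    n₀+s≤ = ℕ.≤-trans (ℕ.+-monoʳ-≤ (n₀ N) s≤5+5N)
                      (ℕ.≤-trans (ℕ.m≤m+n _ (N + 3)) (ℕ.≤-reflexive (slack N)))
  N+c≤n₀ : N + c ≤ n₀ N
  N+c≤n₀ = ℕ.≤-trans (ℕ.+-monoʳ-≤ N c≤7N+8) (ℕ.≤-reflexive (N+7N+8≡n₀ N))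
    where
    N+7N+8≡n₀ : ∀ N → N + (7 * N + 8) ≡ 8 * N + 8
    N+7N+8≡n₀ = solve-∀

family-bound : ∀ {s₀ d m N} → s₀ ≤ 5 → d ≤ 5 → m ≤ N → s₀ + d * m ≤ 5 + 5 * N
family-bound s₀≤5 d≤5 m≤N = ℕ.+-mono-≤ s₀≤5 (ℕ.*-mono-≤ d≤5 m≤N)

s₃≡s₀+3m : ∀ s₀ m → s₃ s₀ m ≡ s₀ + 3 * m
s₃≡s₀+3m s₀ zero = ≡.sym (ℕ.+-identityʳ s₀)
s₃≡s₀+3m s₀ (suc m) = ≡.trans (≡.cong (3 +_) (s₃≡s₀+3m s₀ m)) (step s₀ m)
  where
  step : ∀ s m → 3 + (s + 3 * m) ≡ s + 3 * suc m
  step = solve-∀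

s₅≡s₀+5m : ∀ s₀ m → s₅ s₀ m ≡ s₀ + 5 * m
s₅≡s₀+5m s₀ zero = ≡.sym (ℕ.+-identityʳ s₀)
s₅≡s₀+5m s₀ (suc m) = ≡.trans (≡.cong (5 +_) (s₅≡s₀+5m s₀ m)) (step s₀ m)
  where
  step : ∀ s m → 5 + (s + 5 * m) ≡ s + 5 * suc m
  step = solve-∀

1+e≤e+s+1+k : ∀ e s k → suc e ≤ e + s + suc k
1+e≤e+s+1+k e s k = ℕ.≤-trans (ℕ.≤-reflexive (ℕ.+-comm 1 e)) (ℕ.+-mono-≤ (ℕ.m≤m+n e s) (s≤s z≤n))

m≤e₃ : ∀ s₀ e₀ m → m ≤ e₃ s₀ e₀ m
m≤e₃ s₀ e₀ zero = z≤n
m≤e₃ s₀ e₀ (suc m) = ℕ.≤-trans (s≤s (m≤e₃ s₀ e₀ m)) (1+e≤e+s+1+k (e₃ s₀ e₀ m) (s₃ s₀ m) 0)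

m≤e₅ : ∀ s₀ e₀ m → m ≤ e₅ s₀ e₀ m
m≤e₅ s₀ e₀ zero = z≤n
m≤e₅ s₀ e₀ (suc m) = ℕ.≤-trans (s≤s (m≤e₅ s₀ e₀ m)) (1+e≤e+s+1+k (e₅ s₀ e₀ m) (s₅ s₀ m) 1)

poch-⊛-euler-sum : ∀ N {s₀} e₀ L → s₀ ≤ 3 → poch 0 N ⊛ euler-sum s₀ e₀ (n₀ N) L ≈[ suc N ] ∑[ m < L ] q^ e₃ s₀ e₀ m
poch-⊛-euler-sum N {s₀} e₀ L s₀≤3 =
  ≈[]-trans (≈⇒≈[] (⊛-distribˡ-∑ L (poch 0 N) (euler-term s₀ e₀ (n₀ N))))
            (∑-cong-≈[] L λ m _ → poch-⊛-q^-⊛-qbinom (e₃ s₀ e₀ m) λ e≤N → ⌊n₀+s/2⌋-bounds N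
              (≡.subst (_≤ 5 + 5 * N) (≡.sym (s₃≡s₀+3m s₀ m))
                       (family-bound (ℕ.≤-trans s₀≤3 3≤5) 3≤5 (ℕ.≤-trans (m≤e₃ s₀ e₀ m) e≤N))))
  where
  3≤5 : 3 ≤ 5
  3≤5 = ℕ.m≤m+n 3 2

poch-⊛-rr-sum : ∀ N {s₀} e₀ L → s₀ ≤ 5 → poch 0 N ⊛ rr-sum s₀ e₀ (n₀ N) L ≈[ suc N ] ∑[ m < L ] q^ e₅ s₀ e₀ m
poch-⊛-rr-sum N {s₀} e₀ L s₀≤5 =
  ≈[]-trans (≈⇒≈[] (⊛-distribˡ-∑ L (poch 0 N) (rr-term s₀ e₀ (n₀ N))))
            (∑-cong-≈[] L λ m _ → poch-⊛-q^-⊛-qbinom (e₅ s₀ e₀ m) λ e≤N → ⌊n₀+s/2⌋-bounds N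
              (≡.subst (_≤ 5 + 5 * N) (≡.sym (s₅≡s₀+5m s₀ m))
                       (family-bound s₀≤5 ℕ.≤-refl (ℕ.≤-trans (m≤e₅ s₀ e₀ m) e≤N))))

euler-theta rr-theta : ℕ → Series
euler-theta L = ∑[ m < L ] q^ e₃ 1 0 m ⊕ ∑[ m < L ] q^ e₃ 3 1 m
rr-theta L = ∑[ m < L ] q^ e₅ 1 0 m ⊕ ∑[ m < L ] q^ e₅ 5 2 m

poch-≈[]-euler-theta : ∀ N → poch 0 N ≈[ suc N ] euler-theta (suc (n₀ N))
poch-≈[]-euler-theta N = begin
  poch 0 N
    ≈⟨ ≈⇒≈[] (⊛-identityʳ (poch 0 N)) ⟨
  poch 0 N ⊛ 1ₛ
    ≈⟨ ≈⇒≈[] (⊛-cong ≈-refl (euler-poly≈1 {n₀ N} ℕ.≤-refl)) ⟨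
  poch 0 N ⊛ euler-poly (n₀ N) (suc (n₀ N))
    ≈⟨ ≈⇒≈[] (⊛-distribˡ (poch 0 N) (euler-sum 1 0 (n₀ N) (suc (n₀ N))) (euler-sum 3 1 (n₀ N) (suc (n₀ N)))) ⟩
  poch 0 N ⊛ euler-sum 1 0 (n₀ N) (suc (n₀ N)) ⊕ poch 0 N ⊛ euler-sum 3 1 (n₀ N) (suc (n₀ N))
    ≈⟨ ⊕-cong-≈[] (poch-⊛-euler-sum N 0 (suc (n₀ N)) (s≤s z≤n)) (poch-⊛-euler-sum N 1 (suc (n₀ N)) ℕ.≤-refl) ⟩
  euler-theta (suc (n₀ N))                   ∎
  where open ≈[]-Reasoning (suc N)

poch-⊛-rr-poly : ∀ N L → poch 0 N ⊛ rr-poly (n₀ N) L ≈[ suc N ] rr-theta L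
poch-⊛-rr-poly N L =
  ≈[]-trans (≈⇒≈[] (⊛-distribˡ (poch 0 N) _ _))
            (⊕-cong-≈[] (poch-⊛-rr-sum N 0 L (s≤s z≤n)) (poch-⊛-rr-sum N 2 L ℕ.≤-refl))

square-sum : ℕ → Series
square-sum N = ∑[ j < suc N ] (q^ (j * j) ⊛ poch j (N ∸ j))

N<j⇒N<j*j : ∀ {N j} → N < j → N < j * j
N<j⇒N<j*j {N} {suc j} N<j = ℕ.≤-trans N<j (ℕ.m≤m*n (suc j) (suc j))

qbinom-⊛-poch-≈[]-1 : ∀ {N m j} → j ≤ m → N ≤ m ∸ j → qbinom m j ⊛ poch 0 j ≈[ suc N ] 1ₛ
qbinom-⊛-poch-≈[]-1 {N} {m} {j} j≤m N≤m∸j =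
  ≡.subst (λ k → qbinom k j ⊛ poch 0 j ≈[ suc N ] 1ₛ) (ℕ.m+[n∸m]≡n j≤m)
          (≈[]-trans (≈⇒≈[] (qbinom-⊛-poch j (m ∸ j))) (poch-≈[]-1 (m ∸ j) j (s≤s N≤m∸j)))

poch-⊛-schur-term : ∀ N j → poch 0 N ⊛ schur-term (n₀ N) j ≈[ suc N ] q^ (j * j) ⊛ poch j (N ∸ j)
poch-⊛-schur-term N j with ℕ.≤-<-connex j N
... | inj₂ N<j = begin
  poch 0 N ⊛ (q^ (j * j) ⊛ qbinom (n₀ N ∸ j) j)   ≈⟨ ≈⇒≈[] (⊛-left-comm (poch 0 N) (q^ (j * j)) _) ⟩
  q^ (j * j) ⊛ (poch 0 N ⊛ qbinom (n₀ N ∸ j) j)   ≈⟨ q^-⊛-≈[]-0 _ (N<j⇒N<j*j N<j) ⟩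
  0ₛ                                              ≈⟨ q^-⊛-≈[]-0 _ (N<j⇒N<j*j N<j) ⟨
  q^ (j * j) ⊛ poch j (N ∸ j)                     ∎
  where open ≈[]-Reasoning (suc N)
... | inj₁ j≤N = begin
  poch 0 N ⊛ (q^ (j * j) ⊛ B)
    ≈⟨ ≈⇒≈[] (⊛-left-comm (poch 0 N) (q^ (j * j)) B) ⟩
  q^ (j * j) ⊛ (poch 0 N ⊛ B)
    ≈⟨ ≈⇒≈[] (⊛-cong ≈-refl (⊛-cong poch-split ≈-refl)) ⟩
  q^ (j * j) ⊛ ((poch 0 j ⊛ poch j (N ∸ j)) ⊛ B)
    ≈⟨ ≈⇒≈[] (⊛-cong ≈-refl (solve 3 (λ a b c → (a :* b) :* c := b :* (c :* a)) ≈-refl (poch 0 j) (poch j (N ∸ j)) B)) ⟩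
  q^ (j * j) ⊛ (poch j (N ∸ j) ⊛ (B ⊛ poch 0 j))
    ≈⟨ ⊛-cong-≈[] ≈[]-refl (⊛-cong-≈[] ≈[]-refl (qbinom-⊛-poch-≈[]-1 j≤n₀∸j N≤n₀∸j∸j)) ⟩
  q^ (j * j) ⊛ (poch j (N ∸ j) ⊛ 1ₛ)
    ≈⟨ ≈⇒≈[] (⊛-cong ≈-refl (⊛-identityʳ _)) ⟩
  q^ (j * j) ⊛ poch j (N ∸ j)                     ∎
  where
  open ≈[]-Reasoning (suc N)
  B : Series
  B = qbinom (n₀ N ∸ j) j
  poch-split : poch 0 N ≈ poch 0 j ⊛ poch j (N ∸ j)
  poch-split = ≡.subst (λ k → poch 0 k ≈ poch 0 j ⊛ poch j (N ∸ j)) (ℕ.m+[n∸m]≡n j≤N) (poch-+ 0 j (N ∸ j))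
  N+j+j≤n₀ : N + j + j ≤ n₀ N
  N+j+j≤n₀ = ℕ.≤-trans (ℕ.+-mono-≤ (ℕ.+-monoʳ-≤ N j≤N) j≤N)
                       (ℕ.≤-trans (ℕ.m≤m+n (N + N + N) (5 * N + 8)) (ℕ.≤-reflexive (3N+5N+8≡n₀ N)))
    where
    3N+5N+8≡n₀ : ∀ N → N + N + N + (5 * N + 8) ≡ 8 * N + 8
    3N+5N+8≡n₀ = solve-∀
  N+j≤n₀∸j : N + j ≤ n₀ N ∸ j
  N+j≤n₀∸j = ℕ.m+n≤o⇒m≤o∸n (N + j) N+j+j≤n₀
  j≤n₀∸j : j ≤ n₀ N ∸ j
  j≤n₀∸j = ℕ.m+n≤o⇒n≤o N N+j≤n₀∸j
  N≤n₀∸j∸j : N ≤ n₀ N ∸ j ∸ j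
  N≤n₀∸j∸j = ℕ.m+n≤o⇒m≤o∸n N N+j≤n₀∸j

poch-⊛-schur-D : ∀ N → poch 0 N ⊛ schur-D (n₀ N) ≈[ suc N ] square-sum N
poch-⊛-schur-D N = begin
  poch 0 N ⊛ schur-D (n₀ N)
    ≈⟨ ≈⇒≈[] (⊛-distribˡ-∑ (suc (n₀ N)) (poch 0 N) (schur-term (n₀ N))) ⟩
  ∑[ j < suc (n₀ N) ] (poch 0 N ⊛ schur-term (n₀ N) j)
    ≈⟨ ∑-cong-≈[] (suc (n₀ N)) (λ j _ → poch-⊛-schur-term N j) ⟩
  ∑[ j < suc (n₀ N) ] (q^ (j * j) ⊛ poch j (N ∸ j))
    ≡⟨ ≡.cong (λ L → ∑[ j < L ] (q^ (j * j) ⊛ poch j (N ∸ j))) 1+n₀≡ ⟨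
  ∑[ j < n₀ N ∸ N + suc N ] (q^ (j * j) ⊛ poch j (N ∸ j))
    ≈⟨ ∑-extend-≈[] (suc N) (n₀ N ∸ N) (λ j N<j → q^-⊛-≈[]-0 _ (N<j⇒N<j*j N<j)) ⟩
  square-sum N                                              ∎
  where
  open ≈[]-Reasoning (suc N)
  1+n₀≡ : n₀ N ∸ N + suc N ≡ suc (n₀ N)
  1+n₀≡ = ≡.trans (ℕ.+-suc (n₀ N ∸ N) N) (≡.cong suc (ℕ.m∸n+n≡m (ℕ.≤-trans (ℕ.m≤n*m N 8) (ℕ.m≤m+n (8 * N) 8))))

-- The generating function of c₈ modulo 2

distinctProduct : List ℕ → Series
distinctProduct [] = 1ₛ
distinctProduct (x ∷ xs) = (1ₛ ⊕ q^ x) ⊛ distinctProduct xs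

parity-countDistinct : ∀ xs m → parity (countDistinct xs m) ≡ distinctProduct xs m
parity-countDistinct [] zero = refl
parity-countDistinct [] (suc m) = refl
parity-countDistinct (x ∷ xs) m = begin
  parity (countDistinct xs m + (if x ≤ᵇ m then countDistinct xs (m ∸ x) else 0))
    ≡⟨ ℙₚ.+-homo-+ (countDistinct xs m) _ ⟩
  parity (countDistinct xs m) ℙ.+ parity (if x ≤ᵇ m then countDistinct xs (m ∸ x) else 0)
    ≡⟨ ≡.cong₂ ℙ._+_ (parity-countDistinct xs m) (≡.trans (if-float parity (x ≤ᵇ m))
         (≡.cong (λ p → if x ≤ᵇ m then p else 0ℙ) (parity-countDistinct xs (m ∸ x)))) ⟩
  distinctProduct xs m ℙ.+ (if x ≤ᵇ m then distinctProduct xs (m ∸ x) else 0ℙ)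
    ≡⟨ ≡.cong₂ ℙ._+_ (at (⊛-identityˡ (distinctProduct xs)) m) (q^-⊛-coeff x (distinctProduct xs) m) ⟨
  (1ₛ ⊛ distinctProduct xs) m ℙ.+ (q^ x ⊛ distinctProduct xs) m
    ≡⟨ ⊕-coeff (1ₛ ⊛ distinctProduct xs) (q^ x ⊛ distinctProduct xs) m ⟨
  (1ₛ ⊛ distinctProduct xs ⊕ q^ x ⊛ distinctProduct xs) m
    ≡⟨ at (⊛-distribʳ (distinctProduct xs) 1ₛ (q^ x)) m ⟨
  ((1ₛ ⊕ q^ x) ⊛ distinctProduct xs) m ∎
  where open ≡.≡-Reasoning

parity-sum-map : ∀ (g : ℕ → ℕ) (G : ℕ → Series) n k f → (∀ j → parity (g j) ≡ G j n) →
                 parity (sum (map g (applyUpTo f k))) ≡ (∑[ i < k ] G (f i)) n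
parity-sum-map g G n zero f _ = refl
parity-sum-map g G n (suc k) f parity-g = begin
  parity (g (f 0) + sum (map g (applyUpTo (λ i → f (suc i)) k)))
    ≡⟨ ℙₚ.+-homo-+ (g (f 0)) _ ⟩
  parity (g (f 0)) ℙ.+ parity (sum (map g (applyUpTo (λ i → f (suc i)) k)))
    ≡⟨ ≡.cong₂ ℙ._+_ (parity-g (f 0)) (parity-sum-map g G n k (λ i → f (suc i)) parity-g) ⟩
  G (f 0) n ℙ.+ (∑[ i < k ] G (f (suc i))) n
    ≡⟨ ⊕-coeff (G (f 0)) _ n ⟨
  (∑[ i < suc k ] G (f i)) n ∎
  where open ≡.≡-Reasoning

c8-series : ℕ → Series
c8-series N = ∑[ j < suc N ] (q^ (j * j) ⊛ distinctProduct (factors j N))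

parity-c8 : ∀ N → parity (c8 N) ≡ c8-series N N
parity-c8 N = parity-sum-map (λ j → if j * j ≤ᵇ N then countDistinct (factors j N) (N ∸ j * j) else 0)
                             (λ j → q^ (j * j) ⊛ distinctProduct (factors j N)) N (suc N) (λ i → i) parity-term
  where
  parity-term : ∀ j → parity (if j * j ≤ᵇ N then countDistinct (factors j N) (N ∸ j * j) else 0)
                      ≡ (q^ (j * j) ⊛ distinctProduct (factors j N)) N
  parity-term j = ≡.trans (if-float parity (j * j ≤ᵇ N))
    (≡.trans (≡.cong (λ p → if j * j ≤ᵇ N then p else 0ℙ) (parity-countDistinct (factors j N) (N ∸ j * j)))
             (≡.sym (q^-⊛-coeff (j * j) _ N)))

distinctProduct-++ : ∀ xs ys → distinctProduct (xs ++ ys) ≈ distinctProduct xs ⊛ distinctProduct ys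
distinctProduct-++ [] ys = ≈-sym (⊛-identityˡ (distinctProduct ys))
distinctProduct-++ (x ∷ xs) ys = ≈-trans (⊛-cong ≈-refl (distinctProduct-++ xs ys)) (≈-sym (⊛-assoc _ _ _))

distinctProduct-poch : ∀ (g f : ℕ → ℕ) a k → (∀ i → g (f i) ≡ a + suc i) → distinctProduct (map g (applyUpTo f k)) ≈ poch a k
distinctProduct-poch g f a zero _ = ≈-refl
distinctProduct-poch g f a (suc k) g∘f≡ =
  ⊛-cong (⊕-cong ≈-refl (≈-reflexive (≡.cong q^_ (≡.trans (g∘f≡ 0) (ℕ.+-comm a 1)))))
         (distinctProduct-poch g (λ i → f (suc i)) (suc a) k (λ i → ≡.trans (g∘f≡ (suc i)) (ℕ.+-suc a (suc i))))

frobenius : ∀ a → (1ₛ ⊕ q^ a) ⊛ (1ₛ ⊕ q^ a) ≈ 1ₛ ⊕ q^ (a + a)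
frobenius a = ≈-trans (solve 1 (λ x → (𝟙 :+ x) :* (𝟙 :+ x) := 𝟙 :+ x :* x) ≈-refl (q^ a)) (⊕-cong ≈-refl (q^-+ a a))

distinctProduct-poch² : ∀ (g f : ℕ → ℕ) a k → (∀ i → g (f i) ≡ (a + suc i) + (a + suc i)) →
                        distinctProduct (map g (applyUpTo f k)) ≈ poch a k ⊛ poch a k
distinctProduct-poch² g f a zero _ = ≈-sym (⊛-identityˡ 1ₛ)
distinctProduct-poch² g f a (suc k) g∘f≡ = begin
  (1ₛ ⊕ q^ g (f 0)) ⊛ distinctProduct (map g (applyUpTo (λ i → f (suc i)) k))
    ≈⟨ ⊛-cong (⊕-cong ≈-refl (≈-reflexive (≡.cong q^_ (≡.trans (g∘f≡ 0) (≡.cong (λ z → z + z) (ℕ.+-comm a 1))))))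
              (distinctProduct-poch² g (λ i → f (suc i)) (suc a) k
                                     (λ i → ≡.trans (g∘f≡ (suc i)) (≡.cong (λ z → z + z) (ℕ.+-suc a (suc i))))) ⟩
  (1ₛ ⊕ q^ (suc a + suc a)) ⊛ (poch (suc a) k ⊛ poch (suc a) k)
    ≈⟨ ⊛-cong (frobenius (suc a)) ≈-refl ⟨
  ((1ₛ ⊕ q^ suc a) ⊛ (1ₛ ⊕ q^ suc a)) ⊛ (poch (suc a) k ⊛ poch (suc a) k)
    ≈⟨ solve 2 (λ x p → (x :* x) :* (p :* p) := (x :* p) :* (x :* p)) ≈-refl (1ₛ ⊕ q^ suc a) (poch (suc a) k) ⟩
  poch a (suc k) ⊛ poch a (suc k) ∎
  where open ≈-Reasoning

distinctProduct-factors : ∀ j N → distinctProduct (factors j N) ≈ poch 0 j ⊛ (poch j N ⊛ poch j N)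
distinctProduct-factors j N = ≈-trans (distinctProduct-++ (map suc (applyUpTo (λ i → i) j)) _)
  (⊛-cong (distinctProduct-poch suc (λ i → i) 0 j (λ i → refl))
          (distinctProduct-poch² (λ i → 2 * j + 2 * suc i) (λ i → i) j N (λ i → double j i)))
  where
  double : ∀ j i → 2 * j + 2 * suc i ≡ (j + suc i) + (j + suc i)
  double = solve-∀

poch-⊛-poch²-≈[] : ∀ {j N} → j ≤ N → poch 0 j ⊛ (poch j N ⊛ poch j N) ≈[ suc N ] poch 0 N ⊛ poch j (N ∸ j)
poch-⊛-poch²-≈[] {j} {N} j≤N = begin
  poch 0 j ⊛ (poch j N ⊛ poch j N)
    ≈⟨ ≈⇒≈[] (≈-sym (⊛-assoc _ _ _)) ⟩
  (poch 0 j ⊛ poch j N) ⊛ poch j N    ≈⟨ ⊛-cong-≈[] (≈[]-trans (≈⇒≈[] (≈-sym (poch-+ 0 j N))) (poch-≈[]-poch (ℕ.m≤n+m N j)))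
                                                   poch-j-N≈[] ⟩
  poch 0 N ⊛ poch j (N ∸ j)           ∎
  where
  open ≈[]-Reasoning (suc N)
  poch-j-N≈[] : poch j N ≈[ suc N ] poch j (N ∸ j)
  poch-j-N≈[] = ≡.subst (λ k → poch j k ≈[ suc N ] poch j (N ∸ j)) (ℕ.m∸n+n≡m j≤N)
                        (poch-+-≈[] j (N ∸ j) j (s≤s (ℕ.≤-reflexive (≡.sym (ℕ.m+[n∸m]≡n j≤N)))))

c8-series-≈[]-poch-⊛-square-sum : ∀ N → c8-series N ≈[ suc N ] poch 0 N ⊛ square-sum N
c8-series-≈[]-poch-⊛-square-sum N = begin
  ∑[ j < suc N ] (q^ (j * j) ⊛ distinctProduct (factors j N))
    ≈⟨ ∑-cong-≈[] (suc N) (λ j j<1+N → ⊛-cong-≈[] (≈[]-refl {f = q^ (j * j)})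
         (≈[]-trans (≈⇒≈[] (distinctProduct-factors j N)) (poch-⊛-poch²-≈[] (ℕ.≤-pred j<1+N)))) ⟩
  ∑[ j < suc N ] (q^ (j * j) ⊛ (poch 0 N ⊛ poch j (N ∸ j)))
    ≈⟨ ≈⇒≈[] (∑-cong (suc N) (λ j _ → ⊛-left-comm (q^ (j * j)) (poch 0 N) (poch j (N ∸ j)))) ⟩
  ∑[ j < suc N ] (poch 0 N ⊛ (q^ (j * j) ⊛ poch j (N ∸ j)))
    ≈⟨ ≈⇒≈[] (⊛-distribˡ-∑ (suc N) (poch 0 N) (λ j → q^ (j * j) ⊛ poch j (N ∸ j))) ⟨
  poch 0 N ⊛ square-sum N ∎
  where open ≈[]-Reasoning (suc N)

c8-series-≈[]-theta-product : ∀ N → c8-series N ≈[ suc N ] euler-theta (suc (n₀ N)) ⊛ rr-theta (suc (n₀ N))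
c8-series-≈[]-theta-product N = begin
  c8-series N
    ≈⟨ c8-series-≈[]-poch-⊛-square-sum N ⟩
  poch 0 N ⊛ square-sum N
    ≈⟨ ⊛-cong-≈[] ≈[]-refl (poch-⊛-schur-D N) ⟨
  poch 0 N ⊛ (poch 0 N ⊛ schur-D (n₀ N))
    ≈⟨ ≈⇒≈[] (⊛-cong ≈-refl (⊛-cong ≈-refl (schur-D≈rr-poly {n₀ N} ℕ.≤-refl))) ⟩
  poch 0 N ⊛ (poch 0 N ⊛ rr-poly (n₀ N) L)
    ≈⟨ ⊛-cong-≈[] ≈[]-refl (poch-⊛-rr-poly N L) ⟩
  poch 0 N ⊛ rr-theta L
    ≈⟨ ⊛-cong-≈[] (poch-≈[]-euler-theta N) ≈[]-refl ⟩
  euler-theta L ⊛ rr-theta L                        ∎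
  where
  open ≈[]-Reasoning (suc N)
  L : ℕ
  L = suc (n₀ N)

-- The obstruction modulo 49

theta-product-coeff : ∀ L N →
  (∀ {s₀ e₀ s₀′ e₀′} → 6 * e₀ + s₀ ≡ s₀ * s₀ → 10 * e₀′ + s₀′ ≡ s₀′ * s₀′ → ∀ u v → e₃ s₀ e₀ u + e₅ s₀′ e₀′ v ≢ N) →
  (euler-theta L ⊛ rr-theta L) N ≡ 0ℙ
theta-product-coeff L N no-rep = ≡.trans (at (expand A₁ A₂ B₁ B₂) N)
  (⊕-coeff-zero _ _ N (⊕-coeff-zero _ _ N (part refl refl) (part refl refl))
                      (⊕-coeff-zero _ _ N (part refl refl) (part refl refl)))
  where
  A₁ A₂ B₁ B₂ : Series
  A₁ = ∑[ m < L ] q^ e₃ 1 0 m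
  A₂ = ∑[ m < L ] q^ e₃ 3 1 m
  B₁ = ∑[ m < L ] q^ e₅ 1 0 m
  B₂ = ∑[ m < L ] q^ e₅ 5 2 m
  expand : ∀ a₁ a₂ b₁ b₂ → (a₁ ⊕ a₂) ⊛ (b₁ ⊕ b₂) ≈ (a₁ ⊛ b₁ ⊕ a₁ ⊛ b₂) ⊕ (a₂ ⊛ b₁ ⊕ a₂ ⊛ b₂)
  expand = solve 4 (λ a₁ a₂ b₁ b₂ → (a₁ :+ a₂) :* (b₁ :+ b₂) := (a₁ :* b₁ :+ a₁ :* b₂) :+ (a₂ :* b₁ :+ a₂ :* b₂)) ≈-refl
  part : ∀ {s₀ e₀ s₀′ e₀′} → 6 * e₀ + s₀ ≡ s₀ * s₀ → 10 * e₀′ + s₀′ ≡ s₀′ * s₀′ →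
         (∑[ m < L ] q^ e₃ s₀ e₀ m ⊛ ∑[ m < L ] q^ e₅ s₀′ e₀′ m) N ≡ 0ℙ
  part {s₀} {e₀} {s₀′} {e₀′} inv₃ inv₅ = ∑q^-⊛-∑q^-coeff L (e₃ s₀ e₀) (e₅ s₀′ e₀′) N (no-rep inv₃ inv₅)

invariant-step : ∀ k e s → 2 * suc (2 * k) * e + s ≡ s * s →
                 2 * suc (2 * k) * (e + s + k) + (suc (2 * k) + s) ≡ (suc (2 * k) + s) * (suc (2 * k) + s)
invariant-step k e s inv = begin
  2 * d * (e + s + k) + (d + s)          ≡⟨ expand k e s ⟩
  (2 * d * e + s) + (2 * d * s + d * d)  ≡⟨ ≡.cong (_+ (2 * d * s + d * d)) inv ⟩
  s * s + (2 * d * s + d * d)            ≡⟨ square k s ⟩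
  (d + s) * (d + s)                      ∎
  where
  open ≡.≡-Reasoning
  d : ℕ
  d = suc (2 * k)
  expand : ∀ k e s → 2 * suc (2 * k) * (e + s + k) + (suc (2 * k) + s)
                     ≡ (2 * suc (2 * k) * e + s) + (2 * suc (2 * k) * s + suc (2 * k) * suc (2 * k))
  expand = solve-∀
  square : ∀ k s → s * s + (2 * suc (2 * k) * s + suc (2 * k) * suc (2 * k)) ≡ (suc (2 * k) + s) * (suc (2 * k) + s)
  square = solve-∀

e₃-invariant : ∀ {s₀ e₀} → 6 * e₀ + s₀ ≡ s₀ * s₀ → ∀ m → 6 * e₃ s₀ e₀ m + s₃ s₀ m ≡ s₃ s₀ m * s₃ s₀ m
e₃-invariant inv zero = inv
e₃-invariant {s₀} {e₀} inv (suc m) = invariant-step 1 (e₃ s₀ e₀ m) (s₃ s₀ m) (e₃-invariant inv m)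

e₅-invariant : ∀ {s₀ e₀} → 10 * e₀ + s₀ ≡ s₀ * s₀ → ∀ m → 10 * e₅ s₀ e₀ m + s₅ s₀ m ≡ s₅ s₀ m * s₅ s₀ m
e₅-invariant inv zero = inv
e₅-invariant {s₀} {e₀} inv (suc m) = invariant-step 2 (e₅ s₀ e₀ m) (s₅ s₀ m) (e₅-invariant inv m)

residues : List ℕ
residues = 6 ∷ 20 ∷ 27 ∷ 34 ∷ 41 ∷ 48 ∷ []

Obstructed : ℕ → ℕ → ℕ → Set
Obstructed r a b = (30 * r + 5 * a + 3 * b) % 49 ≢ (5 * (a * a) + 3 * (b * b)) % 49

obstructed? : ∀ r → Dec (∀ {a} → a < 49 → ∀ {b} → b < 49 → Obstructed r a b)
obstructed? r = ℕ.allUpTo? (λ a → ℕ.allUpTo? (λ b → ¬? (_ ℕ.≟ _)) 49) 49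

-- Decided by evaluating the check on all 49² pairs of residues.
obstruction : ∀ {r} → r ∈ residues → ∀ {a} → a < 49 → ∀ {b} → b < 49 → Obstructed r a b
obstruction r∈ = toWitness (checked r∈)
  where
  checked : ∀ {r} → r ∈ residues → True (obstructed? r)
  checked (here refl) = _
  checked (there (here refl)) = _
  checked (there (there (here refl))) = _
  checked (there (there (there (here refl)))) = _
  checked (there (there (there (there (here refl))))) = _
  checked (there (there (there (there (there (here refl)))))) = _

quadratic-obstruction : ∀ {r} → r ∈ residues → ∀ n s t → 30 * (49 * n + r) + 5 * s + 3 * t ≢ 5 * (s * s) + 3 * (t * t)
quadratic-obstruction {r} r∈ n s t eq = obstruction r∈ (m%n<n s 49) (m%n<n t 49) congruence
  where
  a b q q′ : ℕ
  a = s % 49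
  b = t % 49
  q = s / 49
  q′ = t / 49
  lhs : ∀ n r a q b q′ → 30 * (49 * n + r) + 5 * (a + q * 49) + 3 * (b + q′ * 49)
                         ≡ (30 * r + 5 * a + 3 * b) + (30 * n + 5 * q + 3 * q′) * 49
  lhs = solve-∀
  rhs : ∀ a q b q′ → 5 * ((a + q * 49) * (a + q * 49)) + 3 * ((b + q′ * 49) * (b + q′ * 49))
                     ≡ (5 * (a * a) + 3 * (b * b)) + (5 * (2 * a * q + q * q * 49) + 3 * (2 * b * q′ + q′ * q′ * 49)) * 49
  rhs = solve-∀
  congruence : (30 * r + 5 * a + 3 * b) % 49 ≡ (5 * (a * a) + 3 * (b * b)) % 49
  congruence = begin
    (30 * r + 5 * a + 3 * b) % 49
      ≡⟨ [m+kn]%n≡m%n (30 * r + 5 * a + 3 * b) (30 * n + 5 * q + 3 * q′) 49 ⟨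
    ((30 * r + 5 * a + 3 * b) + (30 * n + 5 * q + 3 * q′) * 49) % 49
      ≡⟨ ≡.cong (_% 49) (lhs n r a q b q′) ⟨
    (30 * (49 * n + r) + 5 * (a + q * 49) + 3 * (b + q′ * 49)) % 49
      ≡⟨ ≡.cong₂ (λ x y → (30 * (49 * n + r) + 5 * x + 3 * y) % 49) (m≡m%n+[m/n]*n s 49) (m≡m%n+[m/n]*n t 49) ⟨
    (30 * (49 * n + r) + 5 * s + 3 * t) % 49
      ≡⟨ ≡.cong (_% 49) eq ⟩
    (5 * (s * s) + 3 * (t * t)) % 49
      ≡⟨ ≡.cong₂ (λ x y → (5 * (x * x) + 3 * (y * y)) % 49) (m≡m%n+[m/n]*n s 49) (m≡m%n+[m/n]*n t 49) ⟩
    (5 * ((a + q * 49) * (a + q * 49)) + 3 * ((b + q′ * 49) * (b + q′ * 49))) % 49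
      ≡⟨ ≡.cong (_% 49) (rhs a q b q′) ⟩
    ((5 * (a * a) + 3 * (b * b)) + (5 * (2 * a * q + q * q * 49) + 3 * (2 * b * q′ + q′ * q′ * 49)) * 49) % 49
      ≡⟨ [m+kn]%n≡m%n (5 * (a * a) + 3 * (b * b)) (5 * (2 * a * q + q * q * 49) + 3 * (2 * b * q′ + q′ * q′ * 49)) 49 ⟩
    (5 * (a * a) + 3 * (b * b)) % 49 ∎
    where open ≡.≡-Reasoning

no-representation : ∀ {r} → r ∈ residues → ∀ n {s₀ e₀ s₀′ e₀′} → 6 * e₀ + s₀ ≡ s₀ * s₀ → 10 * e₀′ + s₀′ ≡ s₀′ * s₀′ →
                    ∀ u v → e₃ s₀ e₀ u + e₅ s₀′ e₀′ v ≢ 49 * n + r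
no-representation {r} r∈ n {s₀} {e₀} {s₀′} {e₀′} inv₃ inv₅ u v e+e′≡N =
  quadratic-obstruction r∈ n s t (begin
    30 * (49 * n + r) + 5 * s + 3 * t
      ≡⟨ ≡.cong (λ z → 30 * z + 5 * s + 3 * t) e+e′≡N ⟨
    30 * (e + e′) + 5 * s + 3 * t
      ≡⟨ regroup e e′ s t ⟩
    5 * (6 * e + s) + 3 * (10 * e′ + t)
      ≡⟨ ≡.cong₂ (λ x y → 5 * x + 3 * y) (e₃-invariant inv₃ u) (e₅-invariant inv₅ v) ⟩
    5 * (s * s) + 3 * (t * t)                ∎)
  where
  open ≡.≡-Reasoning
  e e′ s t : ℕ
  e = e₃ s₀ e₀ u
  e′ = e₅ s₀′ e₀′ v
  s = s₃ s₀ u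
  t = s₅ s₀′ v
  regroup : ∀ e e′ s t → 30 * (e + e′) + 5 * s + 3 * t ≡ 5 * (6 * e + s) + 3 * (10 * e′ + t)
  regroup = solve-∀

even⇒2∣ : ∀ n → parity n ≡ 0ℙ → 2 ∣ n
even⇒2∣ n even = divides ⌊ n /2⌋ (≡.trans (even⇒≡⌊/2⌋+⌊/2⌋ n even) (h+h≡h*2 ⌊ n /2⌋))
  where
  h+h≡h*2 : ∀ h → h + h ≡ h * 2
  h+h≡h*2 = solve-∀

theorem9 : (n r : ℕ) → r ∈ (6 ∷ 20 ∷ 27 ∷ 34 ∷ 41 ∷ 48 ∷ []) → 2 ∣ c8 (49 * n + r)
theorem9 n r r∈ = even⇒2∣ (c8 N) (begin
  parity (c8 N)                     ≡⟨ parity-c8 N ⟩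
  c8-series N N                     ≡⟨ at< (c8-series-≈[]-theta-product N) N (ℕ.n<1+n N) ⟩
  (euler-theta L ⊛ rr-theta L) N    ≡⟨ theta-product-coeff L N (no-representation r∈ n) ⟩
  0ℙ                                ∎)
  where
  open ≡.≡-Reasoning
  N L : ℕ
  N = 49 * n + r
  L = suc (n₀ N)
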